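{- Let $r\geqslant 1$ be an integer. Then there exists a unique sequence of Laurent polynomials $\{b_i^{(r)}(q)\}_{i=0}^\infty$ in $q$ with nonnegative integral coefficients such that, for every integer $n\geqslant 0$, $$ \sum_{k=0}^n q^{ -rkn}{n\brack k}^r{n+k\brack k}^r=\sum_{i=0}^n q^{ -ni}{n\brack i}{n+i\brack i}b_i^{(r)}(q). $$ Moreover, $b_i^{(r)}(q)=\sum_{k=0}^i P_{k,i}^{(r)}(q)$, where the Laurent polynomials $P_{k,i}^{(r)}(q)$ are defined below (with $P_{k,i}^{(r)}(q)=0$ if $i>kr$).
   Context: For integers $n,k$, the $q$-binomial coefficient is ${n\brack k}=\frac{(q)_n}{(q)_k(q)_{n-k}}$ if $0\leqslant k\leqslant n$ and ${n\brack k}=0$ otherwise, where $(q)_0=1$ and $(q)_n=(1-q)(1-q^2)\cdots(1-q^n)$ for $n\geqslant 1$. For integers $k\geqslant 0$ and $r\geqslant 1$, the Laurent polynomials $P_{k,i}^{(r)}(q)$, $k\leqslant i\leqslant rk$, are defined recursively by $P_{k,k}^{(1)}(q)=1$ and, for $0\leqslant j\leqslant rk$, $P_{k,k+j}^{(r+1)}(q)=\sum_{i=k}^{rk}q^{(j-i)(j+k)}{k+i\brack i}{k\brack i-j}{k+j\brack j}P_{k,i}^{(r)}(q)$; they are set to $0$ for $i<k$ or $i>rk$. (Equivalently, they are the unique Laurent polynomials satisfying ${n\brack k}^r{n+k\brack k}^r=\sum_{i=k}^{\min\{n,rk\}} q^{(rk-i)n}{n\brack i}{n+i\brack i}P_{k,i}^{(r)}(q)$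 for all $n\geqslant k$.) -}

module Defs where

open import Data.Nat as ℕ using (ℕ; zero; suc; _≡ᵇ_; _≤ᵇ_; _∸_)
open import Data.Integer as ℤ using (ℤ; +_; -[1+_]; 0ℤ; 1ℤ; _⊓_; ∣_∣)
open import Data.List using (List; []; _∷_; map; foldr; replicate; _++_; upTo)
open import Data.Bool using (Bool; true; false; if_then_else_; _∧_)

-- Polynomials with integer coefficients: coefficient lists, lowest degree first.

Poly : Set
Poly = List ℤ

infixl 6 _+P_
infixl 7 _*P_

_+P_ : Poly → Poly → Poly
[] +P ys = ys
(x ∷ xs) +P [] = x ∷ xs
(x ∷ xs) +P (y ∷ ys) = (x ℤ.+ y) ∷ (xs +P ys)

_*P_ : Poly → Poly → Poly
[] *P ys = []
(x ∷ xs) *P ys = map (x ℤ.*_) ys +P (0ℤ ∷ (xs *P ys))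

shiftP : ℕ → Poly → Poly
shiftP m xs = replicate m 0ℤ ++ xs

coeffP : Poly → ℕ → ℤ
coeffP [] _ = 0ℤ
coeffP (x ∷ xs) zero = x
coeffP (x ∷ xs) (suc m) = coeffP xs m

-- Laurent polynomials in q with integer coefficients:
-- mkL e cs  represents  q^e * (cs₀ + cs₁ q + cs₂ q² + ...).

record Laurent : Set where
  constructor mkL
  field
    low : ℤ
    cs  : Poly
open Laurent public

coeff : Laurent → ℤ → ℤ
coeff (mkL e xs) z with z ℤ.- e
... | + m = coeffP xs m
... | -[1+ _ ] = 0ℤ

infix 4 _≈_
_≈_ : Laurent → Laurent → Set
p ≈ p' = ∀ z → coeff p z ≡ coeff p' z
  where open import Relation.Binary.PropositionalEquality using (_≡_)

NonnegCoeffs : Laurent → Set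
NonnegCoeffs p = ∀ z → 0ℤ ℤ.≤ coeff p z

0L 1L : Laurent
0L = mkL 0ℤ []
1L = mkL 0ℤ (1ℤ ∷ [])

qˆ : ℤ → Laurent
qˆ z = mkL z (1ℤ ∷ [])

infixl 6 _+L_
infixl 7 _*L_

_+L_ : Laurent → Laurent → Laurent
mkL e xs +L mkL f ys =
  mkL (e ⊓ f) (shiftP (∣ e ℤ.- (e ⊓ f) ∣) xs +P shiftP (∣ f ℤ.- (e ⊓ f) ∣) ys)

_*L_ : Laurent → Laurent → Laurent
mkL e xs *L mkL f ys = mkL (e ℤ.+ f) (xs *P ys)

_^L_ : Laurent → ℕ → Laurent
p ^L zero = 1L
p ^L suc m = p *L (p ^L m)

sumL : List Laurent → Laurent
sumL = foldr _+L_ 0L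

sumTo : ℕ → (ℕ → Laurent) → Laurent
sumTo n f = sumL (map f (upTo (suc n)))

-- Σ_{i=a}^{b} f i   (empty if b < a)
sumRange : ℕ → ℕ → (ℕ → Laurent) → Laurent
sumRange a b f = sumL (map (λ t → f (a ℕ.+ t)) (upTo (suc b ∸ a)))

-- Gaussian (q-)binomial coefficients [n k], via the q-Pascal rule
-- [n+1, k+1] = [n, k] + q^(k+1) [n, k+1], [n,0] = 1, [0,k+1] = 0.

qbinP : ℕ → ℕ → Poly
qbinP zero zero = 1ℤ ∷ []
qbinP zero (suc k) = []
qbinP (suc n) zero = 1ℤ ∷ []
qbinP (suc n) (suc k) = qbinP n k +P shiftP (suc k) (qbinP n (suc k))

qbin : ℕ → ℕ → Laurent
qbin n k = mkL 0ℤ (qbinP n k)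

qbinℤ : ℕ → ℤ → Laurent
qbinℤ n (+ k) = qbin n k
qbinℤ n -[1+ _ ] = 0L

-- The Laurent polynomials P^{(r)}_{k,i}(q)  (written  P r k i).
-- P 0 k i is a dummy value (r ≥ 1 in the paper).

P : ℕ → ℕ → ℕ → Laurent
P zero k i = 0L
P (suc zero) k i = if k ≡ᵇ i then 1L else 0L
P (suc (suc r)) k i =
  if (k ≤ᵇ i) ∧ (i ≤ᵇ suc (suc r) ℕ.* k)
  then sumRange k (suc r ℕ.* k) (λ i' →
         qˆ ((+ j ℤ.- + i') ℤ.* + (j ℕ.+ k))
         *L qbin (k ℕ.+ i') i'
         *L qbinℤ k (+ i' ℤ.- + j)
         *L qbin (k ℕ.+ j) j
         *L P (suc r) k i')
  else 0L
  where
  j : ℕ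
  j = i ∸ k

LHS : ℕ → ℕ → Laurent
LHS r n = sumTo n (λ k →
  qˆ (ℤ.- + (r ℕ.* k ℕ.* n)) *L (qbin n k ^L r) *L (qbin (n ℕ.+ k) k ^L r))

RHS : (ℕ → Laurent) → ℕ → Laurent
RHS b n = sumTo n (λ i →
  qˆ (ℤ.- + (n ℕ.* i)) *L qbin n i *L qbin (n ℕ.+ i) i *L b i)

module Submission where

-- Write h k n = q^{-kn} [n k] [n+k k].
--
-- Seen as a function of n, h k n is a q-analogue of a falling
-- factorial in σ n = q^{-n} + q^{n+1}: it obeys the three-term recurrence
--   (1 - q^{k+1})² h (k+1) n = (σ n - σ k) h k n.
-- From it one gets, by induction on i, the linearization formula
--   h k n · h i n = Σ_{j≤i} c k i j · h (k+j) n,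
-- whose coefficients c k i j are exactly those of the recursion defining
-- P^{(r+1)}.  Iterating gives h k n ^ r = Σ_i P^{(r)}_{k,i} h i n, and summing
-- over k gives the identity.  Positivity of b_i is read off the recursion.
-- Uniqueness holds because the system is triangular: h i n = 0 for n < i and
-- the diagonal entry h i i = q^{-i²}[2i i] is cancellable ([2i i] ≡ 1 mod q).

open import Defs
open import Data.Nat using (ℕ; _≤_)
open import Data.Product using (Σ-syntax; _×_)

open import Data.Nat as ℕ using (zero; suc; _∸_; _<_)
import Data.Nat.Properties as ℕP
open import Data.Nat.Tactic.RingSolver as ℕSolver using ()
open import Data.Integer as ℤ using (ℤ; +_; -[1+_]; 0ℤ; 1ℤ; _⊓_; ∣_∣)
import Data.Integer.Properties as ℤP
open import Data.Integer.Tactic.RingSolver as ℤSolver using ()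
open import Data.List using (List; []; _∷_; map; foldr; applyUpTo)
open import Data.Bool using (Bool; true; false; if_then_else_; _∧_; T)
open import Data.Bool.Properties using (T-∧)
open import Function.Bundles using (Equivalence)
open import Data.Product using (_,_; proj₁; proj₂)
open import Data.Maybe using (Maybe; just; nothing)
open import Data.Empty using (⊥; ⊥-elim)
open import Relation.Nullary using (yes; no)
open import Relation.Binary.Definitions using (tri<; tri≈; tri>)
open import Relation.Binary.PropositionalEquality as Eq
  using (_≡_; refl; sym; trans; cong; cong₂; subst; subst₂)
open import Level using (0ℓ)
open import Algebra.Bundles using (CommutativeRing)
open import Relation.Binary.Structures using (IsEquivalence)
import Relation.Binary.Reasoning.Setoid as SetoidReasoning
import Algebra.Properties.Group as GroupProperties
open import Data.Nat.Induction using (<-rec)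
open import Tactic.RingSolver.Core.AlmostCommutativeRing
  using (AlmostCommutativeRing; fromCommutativeRing)
open import Tactic.RingSolver using (solve-∀)

-- Integer polynomials.
-- A Poly is a coefficient list; two lists are equal as polynomials when all
-- their coefficients agree (trailing zeros are irrelevant).

infix 4 _≈P_
_≈P_ : Poly → Poly → Set
xs ≈P ys = ∀ m → coeffP xs m ≡ coeffP ys m

IsZeroP : Poly → Set
IsZeroP xs = ∀ m → coeffP xs m ≡ 0ℤ

coeffP-+P : ∀ xs ys m → coeffP (xs +P ys) m ≡ coeffP xs m ℤ.+ coeffP ys m
coeffP-+P [] ys m = sym (ℤP.+-identityˡ _)
coeffP-+P (x ∷ xs) [] m = sym (ℤP.+-identityʳ _)
coeffP-+P (x ∷ xs) (y ∷ ys) zero = refl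
coeffP-+P (x ∷ xs) (y ∷ ys) (suc m) = coeffP-+P xs ys m

coeffP-scale : ∀ a ys m → coeffP (map (a ℤ.*_) ys) m ≡ a ℤ.* coeffP ys m
coeffP-scale a [] m = sym (ℤP.*-zeroʳ a)
coeffP-scale a (y ∷ ys) zero = refl
coeffP-scale a (y ∷ ys) (suc m) = coeffP-scale a ys m

coeffP-negate : ∀ ys m → coeffP (map ℤ.-_ ys) m ≡ ℤ.- coeffP ys m
coeffP-negate [] m = refl
coeffP-negate (y ∷ ys) zero = refl
coeffP-negate (y ∷ ys) (suc m) = coeffP-negate ys m

∷-congP : ∀ x {xs ys} → xs ≈P ys → (x ∷ xs) ≈P (x ∷ ys)
∷-congP x p zero = refl
∷-congP x p (suc m) = p m

coeffP-*P : ∀ x xs ys m →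
  coeffP ((x ∷ xs) *P ys) m ≡ x ℤ.* coeffP ys m ℤ.+ coeffP (0ℤ ∷ (xs *P ys)) m
coeffP-*P x xs ys m =
  trans (coeffP-+P (map (x ℤ.*_) ys) _ m) (cong (ℤ._+ _) (coeffP-scale x ys m))

*P-0∷ : ∀ xs ys → (0ℤ ∷ xs) *P ys ≈P 0ℤ ∷ (xs *P ys)
*P-0∷ xs ys m = trans (coeffP-*P 0ℤ xs ys m) (ℤP.+-identityˡ _)

*P-zeroˡ : ∀ xs ys → IsZeroP xs → IsZeroP (xs *P ys)
*P-zeroˡ [] ys z m = refl
*P-zeroˡ (x ∷ xs) ys z m =
  trans (coeffP-*P x xs ys m) (cong₂ ℤ._+_ (cong (ℤ._* coeffP ys m) (z 0)) (tail m))
  where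
  tail : IsZeroP (0ℤ ∷ (xs *P ys))
  tail zero = refl
  tail (suc m) = *P-zeroˡ xs ys (λ k → z (suc k)) m

*P-zeroʳ : ∀ ys → IsZeroP (ys *P [])
*P-zeroʳ [] m = refl
*P-zeroʳ (y ∷ ys) zero = refl
*P-zeroʳ (y ∷ ys) (suc m) = *P-zeroʳ ys m

*P-congˡ : ∀ xs xs' ys → xs ≈P xs' → xs *P ys ≈P xs' *P ys
*P-congˡ [] [] ys p m = refl
*P-congˡ [] (x' ∷ xs') ys p m = sym (*P-zeroˡ (x' ∷ xs') ys (λ k → sym (p k)) m)
*P-congˡ (x ∷ xs) [] ys p m = *P-zeroˡ (x ∷ xs) ys p m
*P-congˡ (x ∷ xs) (x' ∷ xs') ys p m = begin
  coeffP ((x ∷ xs) *P ys) m                           ≡⟨ coeffP-*P x xs ys m ⟩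
  x ℤ.* coeffP ys m ℤ.+ coeffP (0ℤ ∷ (xs *P ys)) m
    ≡⟨ cong₂ ℤ._+_ (cong (ℤ._* coeffP ys m) (p 0))
                   (∷-congP 0ℤ (*P-congˡ xs xs' ys (λ k → p (suc k))) m) ⟩
  x' ℤ.* coeffP ys m ℤ.+ coeffP (0ℤ ∷ (xs' *P ys)) m  ≡⟨ coeffP-*P x' xs' ys m ⟨
  coeffP ((x' ∷ xs') *P ys) m                         ∎
  where open Eq.≡-Reasoning

*P-congʳ : ∀ xs ys ys' → ys ≈P ys' → xs *P ys ≈P xs *P ys'
*P-congʳ [] ys ys' p m = refl
*P-congʳ (x ∷ xs) ys ys' p m = begin
  coeffP ((x ∷ xs) *P ys) m                          ≡⟨ coeffP-*P x xs ys m ⟩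
  x ℤ.* coeffP ys m ℤ.+ coeffP (0ℤ ∷ (xs *P ys)) m
    ≡⟨ cong₂ ℤ._+_ (cong (x ℤ.*_) (p m)) (∷-congP 0ℤ (*P-congʳ xs ys ys' p) m) ⟩
  x ℤ.* coeffP ys' m ℤ.+ coeffP (0ℤ ∷ (xs *P ys')) m ≡⟨ coeffP-*P x xs ys' m ⟨
  coeffP ((x ∷ xs) *P ys') m                         ∎
  where open Eq.≡-Reasoning

*P-distribˡ : ∀ xs ys zs → xs *P (ys +P zs) ≈P xs *P ys +P xs *P zs
*P-distribˡ [] ys zs m = refl
*P-distribˡ (x ∷ xs) ys zs m = begin
  coeffP ((x ∷ xs) *P (ys +P zs)) m ≡⟨ coeffP-*P x xs (ys +P zs) m ⟩
  x ℤ.* coeffP (ys +P zs) m ℤ.+ coeffP (0ℤ ∷ (xs *P (ys +P zs))) m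
    ≡⟨ cong₂ ℤ._+_ (cong (x ℤ.*_) (coeffP-+P ys zs m))
         (trans (∷-congP 0ℤ (*P-distribˡ xs ys zs) m) (coeffP-+P (0ℤ ∷ xs *P ys) (0ℤ ∷ xs *P zs) m)) ⟩
  x ℤ.* (Y ℤ.+ Z) ℤ.+ (XY ℤ.+ XZ) ≡⟨ rearrange x Y Z XY XZ ⟩
  (x ℤ.* Y ℤ.+ XY) ℤ.+ (x ℤ.* Z ℤ.+ XZ)
    ≡⟨ cong₂ ℤ._+_ (coeffP-*P x xs ys m) (coeffP-*P x xs zs m) ⟨
  coeffP ((x ∷ xs) *P ys) m ℤ.+ coeffP ((x ∷ xs) *P zs) m
    ≡⟨ coeffP-+P ((x ∷ xs) *P ys) ((x ∷ xs) *P zs) m ⟨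
  coeffP ((x ∷ xs) *P ys +P (x ∷ xs) *P zs) m ∎
  where
  open Eq.≡-Reasoning
  Y = coeffP ys m
  Z = coeffP zs m
  XY = coeffP (0ℤ ∷ (xs *P ys)) m
  XZ = coeffP (0ℤ ∷ (xs *P zs)) m
  rearrange : ∀ x a b c d → x ℤ.* (a ℤ.+ b) ℤ.+ (c ℤ.+ d) ≡ (x ℤ.* a ℤ.+ c) ℤ.+ (x ℤ.* b ℤ.+ d)
  rearrange = ℤSolver.solve-∀

*P-distribʳ : ∀ xs ys zs → (xs +P ys) *P zs ≈P xs *P zs +P ys *P zs
*P-distribʳ [] ys zs m = refl
*P-distribʳ (x ∷ xs) [] zs m = sym (trans (coeffP-+P ((x ∷ xs) *P zs) [] m) (ℤP.+-identityʳ _))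
*P-distribʳ (x ∷ xs) (y ∷ ys) zs m = begin
  coeffP (((x ℤ.+ y) ∷ (xs +P ys)) *P zs) m ≡⟨ coeffP-*P (x ℤ.+ y) (xs +P ys) zs m ⟩
  (x ℤ.+ y) ℤ.* Z ℤ.+ coeffP (0ℤ ∷ ((xs +P ys) *P zs)) m
    ≡⟨ cong (λ t → (x ℤ.+ y) ℤ.* Z ℤ.+ t)
         (trans (∷-congP 0ℤ (*P-distribʳ xs ys zs) m) (coeffP-+P (0ℤ ∷ xs *P zs) (0ℤ ∷ ys *P zs) m)) ⟩
  (x ℤ.+ y) ℤ.* Z ℤ.+ (XZ ℤ.+ YZ) ≡⟨ rearrange x y Z XZ YZ ⟩
  (x ℤ.* Z ℤ.+ XZ) ℤ.+ (y ℤ.* Z ℤ.+ YZ) ≡⟨ cong₂ ℤ._+_ (coeffP-*P x xs zs m) (coeffP-*P y ys zs m) ⟨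
  coeffP ((x ∷ xs) *P zs) m ℤ.+ coeffP ((y ∷ ys) *P zs) m
    ≡⟨ coeffP-+P ((x ∷ xs) *P zs) ((y ∷ ys) *P zs) m ⟨
  coeffP ((x ∷ xs) *P zs +P (y ∷ ys) *P zs) m ∎
  where
  open Eq.≡-Reasoning
  Z = coeffP zs m
  XZ = coeffP (0ℤ ∷ (xs *P zs)) m
  YZ = coeffP (0ℤ ∷ (ys *P zs)) m
  rearrange : ∀ x y a b c → (x ℤ.+ y) ℤ.* a ℤ.+ (b ℤ.+ c) ≡ (x ℤ.* a ℤ.+ b) ℤ.+ (y ℤ.* a ℤ.+ c)
  rearrange = ℤSolver.solve-∀

*P-∷ʳ : ∀ xs y ys → xs *P (y ∷ ys) ≈P map (y ℤ.*_) xs +P (0ℤ ∷ (xs *P ys))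
*P-∷ʳ [] y ys zero = refl
*P-∷ʳ [] y ys (suc m) = refl
*P-∷ʳ (x ∷ xs) y ys zero = cong (ℤ._+ 0ℤ) (ℤP.*-comm x y)
*P-∷ʳ (x ∷ xs) y ys (suc m) = begin
  coeffP (map (x ℤ.*_) ys +P (xs *P (y ∷ ys))) m ≡⟨ coeffP-+P (map (x ℤ.*_) ys) (xs *P (y ∷ ys)) m ⟩
  coeffP (map (x ℤ.*_) ys) m ℤ.+ coeffP (xs *P (y ∷ ys)) m
    ≡⟨ cong₂ ℤ._+_ (coeffP-scale x ys m)
         (trans (*P-∷ʳ xs y ys m) (trans (coeffP-+P (map (y ℤ.*_) xs) (0ℤ ∷ (xs *P ys)) m)
                (cong (ℤ._+ _) (coeffP-scale y xs m)))) ⟩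
  x ℤ.* coeffP ys m ℤ.+ (y ℤ.* coeffP xs m ℤ.+ XY) ≡⟨ swap x y (coeffP ys m) (coeffP xs m) XY ⟩
  y ℤ.* coeffP xs m ℤ.+ (x ℤ.* coeffP ys m ℤ.+ XY)
    ≡⟨ cong₂ ℤ._+_ (coeffP-scale y xs m) (coeffP-*P x xs ys m) ⟨
  coeffP (map (y ℤ.*_) xs) m ℤ.+ coeffP ((x ∷ xs) *P ys) m
    ≡⟨ coeffP-+P (map (y ℤ.*_) xs) ((x ∷ xs) *P ys) m ⟨
  coeffP (map (y ℤ.*_) xs +P ((x ∷ xs) *P ys)) m ∎
  where
  open Eq.≡-Reasoning
  XY = coeffP (0ℤ ∷ (xs *P ys)) m
  swap : ∀ x y a b c → x ℤ.* a ℤ.+ (y ℤ.* b ℤ.+ c) ≡ y ℤ.* b ℤ.+ (x ℤ.* a ℤ.+ c)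
  swap = ℤSolver.solve-∀

*P-comm : ∀ xs ys → xs *P ys ≈P ys *P xs
*P-comm [] ys m = sym (*P-zeroʳ ys m)
*P-comm (x ∷ xs) ys m = begin
  coeffP ((x ∷ xs) *P ys) m                                ≡⟨ coeffP-+P (map (x ℤ.*_) ys) _ m ⟩
  coeffP (map (x ℤ.*_) ys) m ℤ.+ coeffP (0ℤ ∷ (xs *P ys)) m
    ≡⟨ cong (λ t → coeffP (map (x ℤ.*_) ys) m ℤ.+ t) (∷-congP 0ℤ (*P-comm xs ys) m) ⟩
  coeffP (map (x ℤ.*_) ys) m ℤ.+ coeffP (0ℤ ∷ (ys *P xs)) m ≡⟨ coeffP-+P (map (x ℤ.*_) ys) (0ℤ ∷ (ys *P xs)) m ⟨
  coeffP (map (x ℤ.*_) ys +P (0ℤ ∷ (ys *P xs))) m          ≡⟨ *P-∷ʳ ys x xs m ⟨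
  coeffP (ys *P (x ∷ xs)) m                                ∎
  where open Eq.≡-Reasoning

*P-scale : ∀ a ys zs → map (a ℤ.*_) ys *P zs ≈P map (a ℤ.*_) (ys *P zs)
*P-scale a [] zs m = refl
*P-scale a (y ∷ ys) zs m = begin
  coeffP (((a ℤ.* y) ∷ map (a ℤ.*_) ys) *P zs) m ≡⟨ coeffP-*P (a ℤ.* y) (map (a ℤ.*_) ys) zs m ⟩
  (a ℤ.* y) ℤ.* Z ℤ.+ coeffP (0ℤ ∷ (map (a ℤ.*_) ys *P zs)) m
    ≡⟨ cong (λ t → (a ℤ.* y) ℤ.* Z ℤ.+ t) (trans (∷-congP 0ℤ (*P-scale a ys zs) m) (scale-0∷ m)) ⟩
  (a ℤ.* y) ℤ.* Z ℤ.+ a ℤ.* YZ ≡⟨ factor a y Z YZ ⟩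
  a ℤ.* (y ℤ.* Z ℤ.+ YZ)       ≡⟨ cong (a ℤ.*_) (coeffP-*P y ys zs m) ⟨
  a ℤ.* coeffP ((y ∷ ys) *P zs) m ≡⟨ coeffP-scale a ((y ∷ ys) *P zs) m ⟨
  coeffP (map (a ℤ.*_) ((y ∷ ys) *P zs)) m ∎
  where
  open Eq.≡-Reasoning
  Z = coeffP zs m
  YZ = coeffP (0ℤ ∷ (ys *P zs)) m
  factor : ∀ a y b c → (a ℤ.* y) ℤ.* b ℤ.+ a ℤ.* c ≡ a ℤ.* (y ℤ.* b ℤ.+ c)
  factor = ℤSolver.solve-∀
  scale-0∷ : ∀ m → coeffP (0ℤ ∷ map (a ℤ.*_) (ys *P zs)) m ≡ a ℤ.* coeffP (0ℤ ∷ (ys *P zs)) m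
  scale-0∷ zero = sym (ℤP.*-zeroʳ a)
  scale-0∷ (suc m) = coeffP-scale a (ys *P zs) m

*P-assoc : ∀ xs ys zs → (xs *P ys) *P zs ≈P xs *P (ys *P zs)
*P-assoc [] ys zs m = refl
*P-assoc (x ∷ xs) ys zs m = begin
  coeffP ((map (x ℤ.*_) ys +P (0ℤ ∷ (xs *P ys))) *P zs) m
    ≡⟨ *P-distribʳ (map (x ℤ.*_) ys) (0ℤ ∷ (xs *P ys)) zs m ⟩
  coeffP (map (x ℤ.*_) ys *P zs +P (0ℤ ∷ (xs *P ys)) *P zs) m
    ≡⟨ coeffP-+P (map (x ℤ.*_) ys *P zs) ((0ℤ ∷ (xs *P ys)) *P zs) m ⟩
  coeffP (map (x ℤ.*_) ys *P zs) m ℤ.+ coeffP ((0ℤ ∷ (xs *P ys)) *P zs) m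
    ≡⟨ cong₂ ℤ._+_ (trans (*P-scale x ys zs m) (coeffP-scale x (ys *P zs) m))
         (trans (*P-0∷ (xs *P ys) zs m) (∷-congP 0ℤ (*P-assoc xs ys zs) m)) ⟩
  x ℤ.* coeffP (ys *P zs) m ℤ.+ coeffP (0ℤ ∷ (xs *P (ys *P zs))) m ≡⟨ coeffP-*P x xs (ys *P zs) m ⟨
  coeffP ((x ∷ xs) *P (ys *P zs)) m ∎
  where open Eq.≡-Reasoning

*P-shift : ∀ a xs ys → shiftP a xs *P ys ≈P shiftP a (xs *P ys)
*P-shift zero xs ys m = refl
*P-shift (suc a) xs ys m =
  trans (*P-0∷ (shiftP a xs) ys m) (∷-congP 0ℤ (*P-shift a xs ys) m)

*P-identityˡ : ∀ xs → (1ℤ ∷ []) *P xs ≈P xs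
*P-identityˡ xs m =
  trans (coeffP-*P 1ℤ [] xs m) (trans (cong₂ ℤ._+_ (ℤP.*-identityˡ (coeffP xs m)) (zero-tail m))
        (ℤP.+-identityʳ (coeffP xs m)))
  where
  zero-tail : IsZeroP (0ℤ ∷ [])
  zero-tail zero = refl
  zero-tail (suc m) = refl

coeffAt : Poly → ℤ → ℤ
coeffAt xs (+ m) = coeffP xs m
coeffAt xs -[1+ _ ] = 0ℤ

coeff-mkL : ∀ e xs z → coeff (mkL e xs) z ≡ coeffAt xs (z ℤ.- e)
coeff-mkL e xs z with z ℤ.- e
... | + m = refl
... | -[1+ n ] = refl

coeffAt-+P : ∀ xs ys w → coeffAt (xs +P ys) w ≡ coeffAt xs w ℤ.+ coeffAt ys w
coeffAt-+P xs ys (+ m) = coeffP-+P xs ys m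
coeffAt-+P xs ys -[1+ n ] = refl

coeffAt-negate : ∀ xs w → coeffAt (map ℤ.-_ xs) w ≡ ℤ.- coeffAt xs w
coeffAt-negate xs (+ m) = coeffP-negate xs m
coeffAt-negate xs -[1+ n ] = refl

coeffAt-cong : ∀ {xs ys} → xs ≈P ys → ∀ w → coeffAt xs w ≡ coeffAt ys w
coeffAt-cong p (+ m) = p m
coeffAt-cong p -[1+ n ] = refl

coeffAt-zero : ∀ {xs} → IsZeroP xs → ∀ w → coeffAt xs w ≡ 0ℤ
coeffAt-zero p (+ m) = p m
coeffAt-zero p -[1+ n ] = refl

coeffAt-0∷ : ∀ ys w → coeffAt (0ℤ ∷ ys) w ≡ coeffAt ys (w ℤ.- 1ℤ)
coeffAt-0∷ ys (+ zero) = refl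
coeffAt-0∷ ys (+ suc m) = refl
coeffAt-0∷ ys -[1+ n ] = refl

coeffAt-shift : ∀ a xs w → coeffAt (shiftP a xs) w ≡ coeffAt xs (w ℤ.- + a)
coeffAt-shift zero xs w = cong (coeffAt xs) (sym (ℤP.+-identityʳ w))
coeffAt-shift (suc a) xs w =
  trans (coeffAt-0∷ (shiftP a xs) w) (trans (coeffAt-shift a xs (w ℤ.- 1ℤ))
        (cong (coeffAt xs) (shift-twice w (+ a))))
  where
  shift-twice : ∀ w a → w ℤ.- 1ℤ ℤ.- a ≡ w ℤ.- (1ℤ ℤ.+ a)
  shift-twice = ℤSolver.solve-∀

≈-refl : ∀ {p} → p ≈ p
≈-refl z = refl

≈-sym : ∀ {p q} → p ≈ q → q ≈ p
≈-sym a z = sym (a z)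

≈-trans : ∀ {p q r} → p ≈ q → q ≈ r → p ≈ r
≈-trans a b z = trans (a z) (b z)

mkL-cong : ∀ {e e'} xs ys → e ≡ e' → xs ≈P ys → mkL e xs ≈ mkL e' ys
mkL-cong {e} xs ys refl p z =
  trans (coeff-mkL e xs z) (trans (coeffAt-cong p (z ℤ.- e)) (sym (coeff-mkL e ys z)))

mkL-shift : ∀ e a xs → mkL e xs ≈ mkL (e ℤ.- + a) (shiftP a xs)
mkL-shift e a xs z =
  trans (coeff-mkL e xs z) (sym (trans (coeff-mkL (e ℤ.- + a) (shiftP a xs) z)
        (trans (coeffAt-shift a xs (z ℤ.- (e ℤ.- + a))) (cong (coeffAt xs) (cancel z e (+ a))))))
  where
  cancel : ∀ z e a → z ℤ.- (e ℤ.- a) ℤ.- a ≡ z ℤ.- e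
  cancel = ℤSolver.solve-∀

coeff-mkL-offset : ∀ e xs m → coeff (mkL e xs) (e ℤ.+ + m) ≡ coeffP xs m
coeff-mkL-offset e xs m = trans (coeff-mkL e xs (e ℤ.+ + m)) (cong (coeffAt xs) (cancel e (+ m)))
  where
  cancel : ∀ e m → e ℤ.+ m ℤ.- e ≡ m
  cancel = ℤSolver.solve-∀

mkL-injective : ∀ {e} xs ys → mkL e xs ≈ mkL e ys → xs ≈P ys
mkL-injective {e} xs ys p m =
  trans (sym (coeff-mkL-offset e xs m)) (trans (p (e ℤ.+ + m)) (coeff-mkL-offset e ys m))

mkL-lower : ∀ e m xs → m ℤ.≤ e → mkL e xs ≈ mkL m (shiftP ∣ e ℤ.- m ∣ xs)
mkL-lower e m xs le =
  ≈-trans (mkL-shift e ∣ e ℤ.- m ∣ xs) (mkL-cong (shiftP ∣ e ℤ.- m ∣ xs) _ (offset e m le) (λ _ → refl))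
  where
  offset : ∀ e m → m ℤ.≤ e → e ℤ.- + ∣ e ℤ.- m ∣ ≡ m
  offset e m le =
    trans (cong (λ t → e ℤ.- t) (ℤP.0≤i⇒+∣i∣≡i (ℤP.i≤j⇒0≤j-i le))) (cancel e m)
    where
    cancel : ∀ e m → e ℤ.- (e ℤ.- m) ≡ m
    cancel = ℤSolver.solve-∀

coeff-+L : ∀ p q z → coeff (p +L q) z ≡ coeff p z ℤ.+ coeff q z
coeff-+L (mkL e xs) (mkL f ys) z =
  trans (coeff-mkL (e ⊓ f) _ z) (trans (coeffAt-+P X Y (z ℤ.- (e ⊓ f)))
        (cong₂ ℤ._+_ (trans (sym (coeff-mkL (e ⊓ f) X z)) (sym (mkL-lower e (e ⊓ f) xs (ℤP.i⊓j≤i e f) z)))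
                     (trans (sym (coeff-mkL (e ⊓ f) Y z)) (sym (mkL-lower f (e ⊓ f) ys (ℤP.i⊓j≤j e f) z)))))
  where
  X = shiftP ∣ e ℤ.- (e ⊓ f) ∣ xs
  Y = shiftP ∣ f ℤ.- (e ⊓ f) ∣ ys

-L_ : Laurent → Laurent
-L mkL e xs = mkL e (map ℤ.-_ xs)

coeff--L : ∀ p z → coeff (-L p) z ≡ ℤ.- coeff p z
coeff--L (mkL e xs) z =
  trans (coeff-mkL e (map ℤ.-_ xs) z) (trans (coeffAt-negate xs (z ℤ.- e)) (cong ℤ.-_ (sym (coeff-mkL e xs z))))

coeff-0L : ∀ z → coeff 0L z ≡ 0ℤ
coeff-0L z = trans (coeff-mkL 0ℤ [] z) (coeffAt-zero {[]} (λ _ → refl) (z ℤ.- 0ℤ))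

mkL-zero : ∀ e xs → IsZeroP xs → mkL e xs ≈ 0L
mkL-zero e xs p z = trans (coeff-mkL e xs z) (trans (coeffAt-zero p (z ℤ.- e)) (sym (coeff-0L z)))

*L-lower : ∀ e xs f ys m → m ℤ.≤ e →
  mkL e xs *L mkL f ys ≈ mkL (m ℤ.+ f) (shiftP ∣ e ℤ.- m ∣ xs *P ys)
*L-lower e xs f ys m le = ≈-trans (mkL-lower (e ℤ.+ f) (m ℤ.+ f) (xs *P ys) (ℤP.+-monoˡ-≤ f le))
  (mkL-cong _ _ refl (λ k → trans (cong (λ a → coeffP (shiftP a (xs *P ys)) k) (same-gap e m f))
                                  (sym (*P-shift ∣ e ℤ.- m ∣ xs ys k))))
  where
  same-gap : ∀ e m f → ∣ e ℤ.+ f ℤ.- (m ℤ.+ f) ∣ ≡ ∣ e ℤ.- m ∣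
  same-gap e m f = cong ∣_∣ (gap e m f)
    where
    gap : ∀ e m f → e ℤ.+ f ℤ.- (m ℤ.+ f) ≡ e ℤ.- m
    gap = ℤSolver.solve-∀

*L-comm : ∀ p q → p *L q ≈ q *L p
*L-comm (mkL e xs) (mkL f ys) = mkL-cong (xs *P ys) (ys *P xs) (ℤP.+-comm e f) (*P-comm xs ys)

*L-assoc : ∀ p q r → (p *L q) *L r ≈ p *L (q *L r)
*L-assoc (mkL e xs) (mkL f ys) (mkL g zs) =
  mkL-cong ((xs *P ys) *P zs) (xs *P (ys *P zs)) (ℤP.+-assoc e f g) (*P-assoc xs ys zs)

*L-identityˡ : ∀ p → 1L *L p ≈ p
*L-identityˡ (mkL e xs) = mkL-cong ((1ℤ ∷ []) *P xs) xs (ℤP.+-identityˡ e) (*P-identityˡ xs)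

-- Two representations of equal Laurent polynomials agree after lowering both
-- offsets to their minimum; this makes multiplication respect ≈.
*L-congʳ : ∀ {p p'} q → p ≈ p' → p *L q ≈ p' *L q
*L-congʳ {mkL e xs} {mkL e' xs'} (mkL f ys) eq =
  ≈-trans (*L-lower e xs f ys m (ℤP.i⊓j≤i e e'))
  (≈-trans (mkL-cong (X *P ys) (X' *P ys) refl (*P-congˡ X X' ys X≈X'))
           (≈-sym (*L-lower e' xs' f ys m (ℤP.i⊓j≤j e e'))))
  where
  m = e ⊓ e'
  X = shiftP ∣ e ℤ.- m ∣ xs
  X' = shiftP ∣ e' ℤ.- m ∣ xs'
  X≈X' : X ≈P X'
  X≈X' = mkL-injective X X' (≈-trans (≈-sym (mkL-lower e m xs (ℤP.i⊓j≤i e e')))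
                                     (≈-trans eq (mkL-lower e' m xs' (ℤP.i⊓j≤j e e'))))

*L-distribʳ : ∀ p q r → (p +L q) *L r ≈ (p *L r) +L (q *L r)
*L-distribʳ (mkL e xs) (mkL f ys) (mkL g zs) z = begin
  coeff (mkL m (X +P Y) *L mkL g zs) z      ≡⟨ mkL-cong ((X +P Y) *P zs) _ refl (*P-distribʳ X Y zs) z ⟩
  coeff (mkL (m ℤ.+ g) (X *P zs +P Y *P zs)) z ≡⟨ coeff-mkL (m ℤ.+ g) (X *P zs +P Y *P zs) z ⟩
  coeffAt (X *P zs +P Y *P zs) (z ℤ.- (m ℤ.+ g)) ≡⟨ coeffAt-+P (X *P zs) (Y *P zs) (z ℤ.- (m ℤ.+ g)) ⟩
  coeffAt (X *P zs) (z ℤ.- (m ℤ.+ g)) ℤ.+ coeffAt (Y *P zs) (z ℤ.- (m ℤ.+ g))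
    ≡⟨ cong₂ ℤ._+_ (coeff-mkL (m ℤ.+ g) (X *P zs) z) (coeff-mkL (m ℤ.+ g) (Y *P zs) z) ⟨
  coeff (mkL (m ℤ.+ g) (X *P zs)) z ℤ.+ coeff (mkL (m ℤ.+ g) (Y *P zs)) z
    ≡⟨ cong₂ ℤ._+_ (*L-lower e xs g zs m (ℤP.i⊓j≤i e f) z) (*L-lower f ys g zs m (ℤP.i⊓j≤j e f) z) ⟨
  coeff (mkL e xs *L mkL g zs) z ℤ.+ coeff (mkL f ys *L mkL g zs) z
    ≡⟨ coeff-+L (mkL e xs *L mkL g zs) (mkL f ys *L mkL g zs) z ⟨
  coeff (mkL e xs *L mkL g zs +L mkL f ys *L mkL g zs) z ∎
  where
  open Eq.≡-Reasoning
  m = e ⊓ f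
  X = shiftP ∣ e ℤ.- m ∣ xs
  Y = shiftP ∣ f ℤ.- m ∣ ys

-- The commutative ring of Laurent polynomials.
-- Equality ≈ is wrapped in a record so that its two sides can be inferred by
-- unification; this is what the ring solver and setoid reasoning work with.

infix 4 _≋_
record _≋_ (p q : Laurent) : Set where
  constructor ⟪_⟫
  field coeffwise : p ≈ q
open _≋_ public

≋-isEquivalence : IsEquivalence _≋_
≋-isEquivalence = record
  { refl = ⟪ ≈-refl ⟫ ; sym = λ a → ⟪ ≈-sym (coeffwise a) ⟫
  ; trans = λ a b → ⟪ ≈-trans (coeffwise a) (coeffwise b) ⟫ }

+L-cong : ∀ {p p' q q'} → p ≋ p' → q ≋ q' → p +L q ≋ p' +L q'
+L-cong {p} {p'} {q} {q'} ⟪ a ⟫ ⟪ b ⟫ =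
  ⟪ (λ z → trans (coeff-+L p q z) (trans (cong₂ ℤ._+_ (a z) (b z)) (sym (coeff-+L p' q' z)))) ⟫

+L-assoc : ∀ p q r → (p +L q) +L r ≋ p +L (q +L r)
+L-assoc p q r = ⟪ (λ z → begin
  coeff ((p +L q) +L r) z                 ≡⟨ coeff-+L (p +L q) r z ⟩
  coeff (p +L q) z ℤ.+ coeff r z          ≡⟨ cong (ℤ._+ coeff r z) (coeff-+L p q z) ⟩
  coeff p z ℤ.+ coeff q z ℤ.+ coeff r z   ≡⟨ ℤP.+-assoc (coeff p z) (coeff q z) (coeff r z) ⟩
  coeff p z ℤ.+ (coeff q z ℤ.+ coeff r z) ≡⟨ cong (λ t → coeff p z ℤ.+ t) (coeff-+L q r z) ⟨
  coeff p z ℤ.+ coeff (q +L r) z          ≡⟨ coeff-+L p (q +L r) z ⟨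
  coeff (p +L (q +L r)) z                 ∎) ⟫
  where open Eq.≡-Reasoning

+L-comm : ∀ p q → p +L q ≋ q +L p
+L-comm p q = ⟪ (λ z →
  trans (coeff-+L p q z) (trans (ℤP.+-comm (coeff p z) (coeff q z)) (sym (coeff-+L q p z)))) ⟫

+L-identityˡ : ∀ p → 0L +L p ≋ p
+L-identityˡ p = ⟪ (λ z →
  trans (coeff-+L 0L p z) (trans (cong (ℤ._+ coeff p z) (coeff-0L z)) (ℤP.+-identityˡ (coeff p z)))) ⟫

+L-identityʳ : ∀ p → p +L 0L ≋ p
+L-identityʳ p = ⟪ (λ z →
  trans (coeff-+L p 0L z) (trans (cong (λ t → coeff p z ℤ.+ t) (coeff-0L z)) (ℤP.+-identityʳ (coeff p z)))) ⟫

-L-inverseˡ : ∀ p → (-L p) +L p ≋ 0L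
-L-inverseˡ p = ⟪ (λ z → trans (coeff-+L (-L p) p z) (trans (cong (ℤ._+ coeff p z) (coeff--L p z))
  (trans (ℤP.+-inverseˡ (coeff p z)) (sym (coeff-0L z))))) ⟫

-L-inverseʳ : ∀ p → p +L (-L p) ≋ 0L
-L-inverseʳ p = ⟪ (λ z → trans (coeff-+L p (-L p) z) (trans (cong (λ t → coeff p z ℤ.+ t) (coeff--L p z))
  (trans (ℤP.+-inverseʳ (coeff p z)) (sym (coeff-0L z))))) ⟫

-L-cong : ∀ {p q} → p ≋ q → -L p ≋ -L q
-L-cong {p} {q} ⟪ a ⟫ = ⟪ (λ z → trans (coeff--L p z) (trans (cong ℤ.-_ (a z)) (sym (coeff--L q z)))) ⟫

*L-cong : ∀ {p p' q q'} → p ≋ p' → q ≋ q' → p *L q ≋ p' *L q'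
*L-cong {p} {p'} {q} {q'} ⟪ a ⟫ ⟪ b ⟫ =
  ⟪ ≈-trans (*L-congʳ q a) (≈-trans (*L-comm p' q) (≈-trans (*L-congʳ p' b) (*L-comm q' p'))) ⟫

laurentRing : CommutativeRing 0ℓ 0ℓ
laurentRing = record
  { Carrier = Laurent ; _≈_ = _≋_ ; _+_ = _+L_ ; _*_ = _*L_ ; -_ = -L_ ; 0# = 0L ; 1# = 1L
  ; isCommutativeRing = record
    { isRing = record
      { +-isAbelianGroup = record
        { isGroup = record
          { isMonoid = record
            { isSemigroup = record
              { isMagma = record { isEquivalence = ≋-isEquivalence ; ∙-cong = +L-cong }
              ; assoc = +L-assoc }
            ; identity = +L-identityˡ , +L-identityʳ }
          ; inverse = -L-inverseˡ , -L-inverseʳ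
          ; ⁻¹-cong = -L-cong }
        ; comm = +L-comm }
      ; *-cong = *L-cong
      ; *-assoc = λ p q r → ⟪ *L-assoc p q r ⟫
      ; *-identity = (λ p → ⟪ *L-identityˡ p ⟫) , (λ p → ⟪ ≈-trans (*L-comm p 1L) (*L-identityˡ p) ⟫)
      ; distrib = (λ p q r → ⟪ ≈-trans (*L-comm p (q +L r)) (≈-trans (*L-distribʳ q r p)
                                (coeffwise (+L-cong ⟪ *L-comm q p ⟫ ⟪ *L-comm r p ⟫))) ⟫)
                , (λ p q r → ⟪ *L-distribʳ q r p ⟫) }
    ; *-comm = λ p q → ⟪ *L-comm p q ⟫ } }

open CommutativeRing laurentRing public
  using ( setoid; +-assoc; +-identityˡ; +-identityʳ; -‿inverseʳ
        ; *-comm; *-assoc; *-identityˡ; *-identityʳ; distribˡ; zeroˡ; zeroʳ )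
  renaming (refl to ≋-refl; sym to ≋-sym; trans to ≋-trans; reflexive to ≋-reflexive)

-- Congruences with the fixed operand explicit: _+L_ and _*L_ compute, so that
-- operand could not be recovered from an equation by unification.

+-congˡ : ∀ a {x y} → x ≋ y → a +L x ≋ a +L y
+-congˡ a = +L-cong (≋-refl {a})

+-congʳ : ∀ a {x y} → x ≋ y → x +L a ≋ y +L a
+-congʳ a e = +L-cong e (≋-refl {a})

*-congˡ : ∀ a {x y} → x ≋ y → a *L x ≋ a *L y
*-congˡ a = *L-cong (≋-refl {a})

*-congʳ : ∀ a {x y} → x ≋ y → x *L a ≋ y *L a
*-congʳ a e = *L-cong e (≋-refl {a})

open GroupProperties (CommutativeRing.+-group laurentRing) public using () renaming (∙-cancelˡ to +-cancelˡ)

*-vanishʳ : ∀ a {x} → x ≋ 0L → a *L x ≋ 0L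
*-vanishʳ a e = ≋-trans (*-congˡ a e) (zeroʳ a)

*-vanishˡ : ∀ a {x} → x ≋ 0L → x *L a ≋ 0L
*-vanishˡ a e = ≋-trans (*-congʳ a e) (zeroˡ a)

module ≋-Reasoning = SetoidReasoning setoid

-- The ring solver for Laurent polynomials.  It needs a (partial) test for
-- zero, which here recognises coefficient lists of literal zeros.
laurentSolverRing : AlmostCommutativeRing 0ℓ 0ℓ
laurentSolverRing = fromCommutativeRing laurentRing isZero
  where
  zeroList? : (xs : Poly) → Maybe (IsZeroP xs)
  zeroList? [] = just (λ m → refl)
  zeroList? (+ zero ∷ xs) with zeroList? xs
  ... | nothing = nothing
  ... | just p = just (λ { zero → refl ; (suc m) → p m })
  zeroList? (+ suc _ ∷ xs) = nothing
  zeroList? (-[1+ _ ] ∷ xs) = nothing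
  isZero : ∀ x → Maybe (0L ≋ x)
  isZero (mkL e xs) with zeroList? xs
  ... | nothing = nothing
  ... | just p = just ⟪ ≈-sym {mkL e xs} {0L} (mkL-zero e xs p) ⟫

-- Cancellation.
-- A Laurent polynomial that is a polynomial with constant term 1 is not a
-- zero divisor: comparing coefficients from the bottom up, p·X = 0 forces
-- every coefficient of X to vanish.

ConstantTermOne : Laurent → Set
ConstantTermOne p = Σ[ ps ∈ Poly ] (p ≋ mkL 0ℤ (1ℤ ∷ ps))

mkL-zero⁻¹ : ∀ e xs → mkL e xs ≋ 0L → IsZeroP xs
mkL-zero⁻¹ e xs ⟪ p ⟫ m =
  trans (sym (coeff-mkL-offset e xs m)) (trans (p (e ℤ.+ + m)) (coeff-0L (e ℤ.+ + m)))

*P-cancel-zero : ∀ ps xs → IsZeroP ((1ℤ ∷ ps) *P xs) → IsZeroP xs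
*P-cancel-zero ps [] p m = refl
*P-cancel-zero ps (x ∷ xs) p = λ { zero → x≡0 ; (suc m) → *P-cancel-zero ps xs tail-zero m }
  where
  x≡0 : x ≡ 0ℤ
  x≡0 = trans (sym (trans (coeffP-*P 1ℤ ps (x ∷ xs) zero) (lowest x))) (p zero)
    where
    lowest : ∀ x → 1ℤ ℤ.* x ℤ.+ 0ℤ ≡ x
    lowest = ℤSolver.solve-∀
  shifted : (1ℤ ∷ ps) *P (x ∷ xs) ≈P 0ℤ ∷ ((1ℤ ∷ ps) *P xs)
  shifted m = begin
    coeffP ((1ℤ ∷ ps) *P (x ∷ xs)) m
      ≡⟨ *P-congʳ (1ℤ ∷ ps) (x ∷ xs) (0ℤ ∷ xs) (λ { zero → x≡0 ; (suc _) → refl }) m ⟩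
    coeffP ((1ℤ ∷ ps) *P (0ℤ ∷ xs)) m ≡⟨ *P-comm (1ℤ ∷ ps) (0ℤ ∷ xs) m ⟩
    coeffP ((0ℤ ∷ xs) *P (1ℤ ∷ ps)) m ≡⟨ *P-0∷ xs (1ℤ ∷ ps) m ⟩
    coeffP (0ℤ ∷ (xs *P (1ℤ ∷ ps))) m ≡⟨ ∷-congP 0ℤ (*P-comm xs (1ℤ ∷ ps)) m ⟩
    coeffP (0ℤ ∷ ((1ℤ ∷ ps) *P xs)) m ∎
    where open Eq.≡-Reasoning
  tail-zero : IsZeroP ((1ℤ ∷ ps) *P xs)
  tail-zero m = trans (sym (shifted (suc m))) (p (suc m))

*L-cancel-zero : ∀ {p} → ConstantTermOne p → ∀ W → p *L W ≋ 0L → W ≋ 0L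
*L-cancel-zero (ps , p≋) (mkL e xs) pW≋0 =
  ⟪ mkL-zero e xs (*P-cancel-zero ps xs (mkL-zero⁻¹ (0ℤ ℤ.+ e) ((1ℤ ∷ ps) *P xs)
      (≋-trans (≋-sym (*-congʳ (mkL e xs) p≋)) pW≋0))) ⟫

*L-cancelˡ : ∀ {p} → ConstantTermOne p → ∀ X Y → p *L X ≋ p *L Y → X ≋ Y
*L-cancelˡ {p} one X Y pX≋pY = difference-zero X Y (*L-cancel-zero one (X +L -L Y)
  (≋-trans (distrib-sub p X Y) (≋-trans (+-congʳ (-L (p *L Y)) pX≋pY) (sub-self (p *L Y)))))
  where
  distrib-sub : ∀ p X Y → p *L (X +L -L Y) ≋ p *L X +L -L (p *L Y)
  distrib-sub = solve-∀ laurentSolverRing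
  sub-self : ∀ a → a +L -L a ≋ 0L
  sub-self = solve-∀ laurentSolverRing
  add-back : ∀ X Y → (X +L -L Y) +L Y ≋ X
  add-back = solve-∀ laurentSolverRing
  difference-zero : ∀ X Y → X +L -L Y ≋ 0L → X ≋ Y
  difference-zero X Y d≋0 = ≋-trans (≋-sym (add-back X Y)) (≋-trans (+-congʳ Y d≋0) (+-identityˡ Y))

qˆ-+ : ∀ x y → qˆ x *L qˆ y ≋ qˆ (x ℤ.+ y)
qˆ-+ x y = ⟪ mkL-cong ((1ℤ ∷ []) *P (1ℤ ∷ [])) (1ℤ ∷ []) refl (λ { zero → refl ; (suc m) → refl }) ⟫

qˆ-cong : ∀ {x y} → x ≡ y → qˆ x ≋ qˆ y
qˆ-cong refl = ≋-refl

qˆ-cancelˡ : ∀ z X Y → qˆ z *L X ≋ qˆ z *L Y → X ≋ Y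
qˆ-cancelˡ z X Y qX≋qY = begin
  X                       ≈⟨ *-identityˡ X ⟨
  1L *L X                 ≈⟨ *-congʳ X inverse ⟩
  (qˆ (ℤ.- z) *L qˆ z) *L X ≈⟨ *-assoc (qˆ (ℤ.- z)) (qˆ z) X ⟩
  qˆ (ℤ.- z) *L (qˆ z *L X) ≈⟨ *-congˡ (qˆ (ℤ.- z)) qX≋qY ⟩
  qˆ (ℤ.- z) *L (qˆ z *L Y) ≈⟨ *-assoc (qˆ (ℤ.- z)) (qˆ z) Y ⟨
  (qˆ (ℤ.- z) *L qˆ z) *L Y ≈⟨ *-congʳ Y inverse ⟨
  1L *L Y                 ≈⟨ *-identityˡ Y ⟩
  Y                       ∎
  where
  open ≋-Reasoning
  inverse : 1L ≋ qˆ (ℤ.- z) *L qˆ z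
  inverse = ≋-sym (≋-trans (qˆ-+ (ℤ.- z) z) (qˆ-cong (ℤP.+-inverseˡ z)))

-- Finite sums.
-- Σ< N f = f 0 + f 1 + ... + f (N-1); the sums sumTo and sumRange of Defs
-- are instances.

Σ< : ℕ → (ℕ → Laurent) → Laurent
Σ< N f = sumL (applyUpTo f N)

private
  map-applyUpTo : ∀ (f : ℕ → Laurent) (g : ℕ → ℕ) N →
    map f (applyUpTo g N) ≡ applyUpTo (λ t → f (g t)) N
  map-applyUpTo f g zero = refl
  map-applyUpTo f g (suc N) = cong (f (g 0) ∷_) (map-applyUpTo f (λ t → g (suc t)) N)

sumTo≡Σ< : ∀ n f → sumTo n f ≡ Σ< (suc n) f
sumTo≡Σ< n f = cong sumL (map-applyUpTo f (λ t → t) (suc n))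

sumRange≡Σ< : ∀ a b f → sumRange a b f ≡ Σ< (suc b ∸ a) (λ t → f (a ℕ.+ t))
sumRange≡Σ< a b f = cong sumL (map-applyUpTo (λ t → f (a ℕ.+ t)) (λ t → t) (suc b ∸ a))

Σ<-cong : ∀ N {f g} → (∀ j → j < N → f j ≋ g j) → Σ< N f ≋ Σ< N g
Σ<-cong zero p = ≋-refl
Σ<-cong (suc N) p = +L-cong (p 0 (ℕ.s≤s ℕ.z≤n)) (Σ<-cong N (λ j lt → p (suc j) (ℕ.s≤s lt)))

Σ<-zero : ∀ N f → (∀ j → j < N → f j ≋ 0L) → Σ< N f ≋ 0L
Σ<-zero zero f p = ≋-refl
Σ<-zero (suc N) f p =
  ≋-trans (+L-cong (p 0 (ℕ.s≤s ℕ.z≤n)) (Σ<-zero N (λ j → f (suc j)) (λ j lt → p (suc j) (ℕ.s≤s lt))))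
          (+-identityˡ 0L)

Σ<-last : ∀ N f → Σ< (suc N) f ≋ Σ< N f +L f N
Σ<-last zero f = ≋-trans (+-identityʳ (f 0)) (≋-sym (+-identityˡ (f 0)))
Σ<-last (suc N) f = ≋-trans (+-congˡ (f 0) (Σ<-last N (λ j → f (suc j))))
                            (≋-sym (+-assoc (f 0) (Σ< N (λ j → f (suc j))) (f (suc N))))

Σ<-+ : ∀ N f g → Σ< N (λ j → f j +L g j) ≋ Σ< N f +L Σ< N g
Σ<-+ zero f g = ≋-sym (+-identityˡ 0L)
Σ<-+ (suc N) f g = ≋-trans (+-congˡ (f 0 +L g 0) (Σ<-+ N (λ j → f (suc j)) (λ j → g (suc j))))
  (interchange (f 0) (g 0) (Σ< N (λ j → f (suc j))) (Σ< N (λ j → g (suc j))))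
  where
  interchange : ∀ a b c d → (a +L b) +L (c +L d) ≋ (a +L c) +L (b +L d)
  interchange = solve-∀ laurentSolverRing

Σ<-*ˡ : ∀ N a f → a *L Σ< N f ≋ Σ< N (λ j → a *L f j)
Σ<-*ˡ zero a f = zeroʳ a
Σ<-*ˡ (suc N) a f = ≋-trans (distribˡ a (f 0) (Σ< N (λ j → f (suc j))))
                             (+-congˡ (a *L f 0) (Σ<-*ˡ N a (λ j → f (suc j))))

Σ<-*ʳ : ∀ N f a → Σ< N f *L a ≋ Σ< N (λ j → f j *L a)
Σ<-*ʳ N f a = ≋-trans (*-comm (Σ< N f) a)
  (≋-trans (Σ<-*ˡ N a f) (Σ<-cong N (λ j _ → *-comm a (f j))))

Σ<-split : ∀ a b f → Σ< (a ℕ.+ b) f ≋ Σ< a f +L Σ< b (λ t → f (a ℕ.+ t))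
Σ<-split zero b f = ≋-sym (+-identityˡ (Σ< b f))
Σ<-split (suc a) b f = ≋-trans (+-congˡ (f 0) (Σ<-split a b (λ j → f (suc j))))
  (≋-sym (+-assoc (f 0) (Σ< a (λ j → f (suc j))) (Σ< b (λ t → f (suc (a ℕ.+ t))))))

Σ<-swap : ∀ N M (f : ℕ → ℕ → Laurent) →
  Σ< N (λ i → Σ< M (λ j → f i j)) ≋ Σ< M (λ j → Σ< N (λ i → f i j))
Σ<-swap zero M f = ≋-sym (Σ<-zero M (λ _ → 0L) (λ _ _ → ≋-refl))
Σ<-swap (suc N) M f = ≋-trans (+-congˡ (Σ< M (f 0)) (Σ<-swap N M (λ i j → f (suc i) j)))
  (≋-sym (Σ<-+ M (f 0) (λ j → Σ< N (λ i → f (suc i) j))))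

Σ<-extend : ∀ N M f → N ≤ M → (∀ j → N ≤ j → j < M → f j ≋ 0L) → Σ< M f ≋ Σ< N f
Σ<-extend N M f N≤M p = subst (λ t → Σ< t f ≋ Σ< N f) (ℕP.m+[n∸m]≡n N≤M)
  (≋-trans (Σ<-split N (M ∸ N) f)
  (≋-trans (+-congˡ (Σ< N f) (Σ<-zero (M ∸ N) (λ t → f (N ℕ.+ t)) tail-zero)) (+-identityʳ (Σ< N f))))
  where
  tail-zero : ∀ t → t < M ∸ N → f (N ℕ.+ t) ≋ 0L
  tail-zero t lt = p (N ℕ.+ t) (ℕP.m≤m+n N t)
    (subst (λ w → N ℕ.+ t < w) (ℕP.m+[n∸m]≡n N≤M) (ℕP.+-monoʳ-< N lt))

Σ<-single : ∀ M k f → k < M → (∀ i → (i ≡ k → ⊥) → f i ≋ 0L) → Σ< M f ≋ f k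
Σ<-single M k f k<M p = begin
  Σ< M f          ≈⟨ Σ<-extend (suc k) M f k<M (λ j k<j _ → p j (λ j≡k → ℕP.<-irrefl (sym j≡k) k<j)) ⟩
  Σ< (suc k) f    ≈⟨ Σ<-last k f ⟩
  Σ< k f +L f k   ≈⟨ +-congʳ (f k) (Σ<-zero k f (λ j j<k → p j (λ j≡k → ℕP.<-irrefl j≡k j<k))) ⟩
  0L +L f k       ≈⟨ +-identityˡ (f k) ⟩
  f k             ∎
  where open ≋-Reasoning

Σ<-shift : ∀ k M f → k ≤ M → (∀ i → i < k → f i ≋ 0L) → (∀ j → M ∸ k ≤ j → j < M → f (k ℕ.+ j) ≋ 0L) →
  Σ< M (λ j → f (k ℕ.+ j)) ≋ Σ< M f
Σ<-shift k M f k≤M below above = begin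
  Σ< M (λ j → f (k ℕ.+ j))                  ≈⟨ Σ<-extend (M ∸ k) M (λ j → f (k ℕ.+ j)) (ℕP.m∸n≤m M k) above ⟩
  Σ< (M ∸ k) (λ j → f (k ℕ.+ j))            ≈⟨ +-identityˡ _ ⟨
  0L +L Σ< (M ∸ k) (λ j → f (k ℕ.+ j))      ≈⟨ +-congʳ (Σ< (M ∸ k) (λ j → f (k ℕ.+ j))) (Σ<-zero k f below) ⟨
  Σ< k f +L Σ< (M ∸ k) (λ j → f (k ℕ.+ j))  ≈⟨ Σ<-split k (M ∸ k) f ⟨
  Σ< (k ℕ.+ (M ∸ k)) f                      ≡⟨ cong (λ t → Σ< t f) (ℕP.m+[n∸m]≡n k≤M) ⟩
  Σ< M f                                    ∎
  where open ≋-Reasoning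

-- q-binomial coefficients.

q^ : ℕ → Laurent
q^ t = qˆ (+ t)

infix 8 1-_
1-_ : Laurent → Laurent
1- x = 1L +L -L x

q^-+ : ∀ a b → q^ a *L q^ b ≋ q^ (a ℕ.+ b)
q^-+ a b = qˆ-+ (+ a) (+ b)

1--cong : ∀ {x y} → x ≋ y → 1- x ≋ 1- y
1--cong e = +-congˡ 1L (-L-cong e)

qbin-0 : ∀ n → qbin n 0 ≋ 1L
qbin-0 zero = ≋-refl
qbin-0 (suc n) = ≋-refl

qbin-pascal : ∀ n k → qbin (suc n) (suc k) ≋ qbin n k +L q^ (suc k) *L qbin n (suc k)
qbin-pascal n k = ⟪ (λ z → begin
  coeff (mkL 0ℤ (X +P Y)) z                 ≡⟨ coeff-mkL 0ℤ (X +P Y) z ⟩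
  coeffAt (X +P Y) (z ℤ.- 0ℤ)               ≡⟨ coeffAt-+P X Y (z ℤ.- 0ℤ) ⟩
  coeffAt X (z ℤ.- 0ℤ) ℤ.+ coeffAt Y (z ℤ.- 0ℤ)
    ≡⟨ cong₂ ℤ._+_ (coeff-mkL 0ℤ X z) (coeff-mkL 0ℤ Y z) ⟨
  coeff (mkL 0ℤ X) z ℤ.+ coeff (mkL 0ℤ Y) z ≡⟨ coeff-+L (mkL 0ℤ X) (mkL 0ℤ Y) z ⟨
  coeff (qbin n k +L mkL 0ℤ Y) z            ≡⟨ coeffwise (+-congˡ (qbin n k) shift≋) z ⟩
  coeff (qbin n k +L q^ (suc k) *L qbin n (suc k)) z ∎) ⟫
  where
  open Eq.≡-Reasoning
  X = qbinP n k
  Y = shiftP (suc k) (qbinP n (suc k))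
  shift≋ : mkL 0ℤ Y ≋ q^ (suc k) *L qbin n (suc k)
  shift≋ = ⟪ ≈-trans {mkL 0ℤ Y} (mkL-cong Y Y (sym (ℤP.+-inverseʳ (+ suc k))) (λ _ → refl))
             (≈-trans {mkL (+ suc k ℤ.- + suc k) Y} (≈-sym {mkL (+ suc k) _} (mkL-shift (+ suc k) (suc k) (qbinP n (suc k))))
                      (mkL-cong _ _ (sym (ℤP.+-identityʳ (+ suc k))) (λ m → sym (*P-identityˡ (qbinP n (suc k)) m)))) ⟫

qbin-vanish : ∀ n k → n < k → qbin n k ≋ 0L
qbin-vanish zero (suc k) lt = ≋-refl
qbin-vanish (suc n) (suc k) (ℕ.s≤s lt) = begin
  qbin (suc n) (suc k)                      ≈⟨ qbin-pascal n k ⟩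
  qbin n k +L q^ (suc k) *L qbin n (suc k)  ≈⟨ +L-cong (qbin-vanish n k lt)
                                                 (*-congˡ (q^ (suc k)) (qbin-vanish n (suc k) (ℕP.m<n⇒m<1+n lt))) ⟩
  0L +L q^ (suc k) *L 0L                    ≈⟨ ≋-trans (+-identityˡ (q^ (suc k) *L 0L)) (zeroʳ (q^ (suc k))) ⟩
  0L                                        ∎
  where open ≋-Reasoning

qbin-diagonal : ∀ n → qbin n n ≋ 1L
qbin-diagonal zero = ≋-refl
qbin-diagonal (suc n) = ≋-trans (qbin-pascal n n) (≋-trans
  (+L-cong (qbin-diagonal n) (*-vanishʳ (q^ (suc n)) (qbin-vanish n (suc n) (ℕP.n<1+n n))))
  (+-identityʳ 1L))

-- Absorption identities, the q-analogues of (k+1)·C(n,k+1) = (n-k)·C(n,k)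
-- and (k+1)·C(n+1,k+1) = (n+1)·C(n,k).

qbin-absorb-lower : ∀ n k → 1- q^ (suc k) *L qbin n (suc k) ≋ 1- q^ (n ∸ k) *L qbin n k
qbin-absorb-lower zero zero = ≋-trans (zeroʳ (1- q^ 1)) (≋-sym (≋-trans (*-identityʳ (1- q^ 0)) (-‿inverseʳ 1L)))
qbin-absorb-lower zero (suc k) = ≋-trans (zeroʳ (1- q^ (suc (suc k)))) (≋-sym (zeroʳ (1- q^ 0)))
qbin-absorb-lower (suc n) zero = begin
  1- q *L qbin (suc n) 1          ≈⟨ *-congˡ (1- q) (≋-trans (qbin-pascal n 0) (+-congʳ (q *L qbin n 1) (qbin-0 n))) ⟩
  1- q *L (1L +L q *L qbin n 1)   ≈⟨ expand q (qbin n 1) ⟩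
  1- q +L q *L (1- q *L qbin n 1) ≈⟨ +-congˡ (1- q) (*-congˡ q (≋-trans (qbin-absorb-lower n 0)
                                                       (*-congˡ (1- q^ n) (qbin-0 n)))) ⟩
  1- q +L q *L (1- q^ n *L 1L)    ≈⟨ collect q (q^ n) ⟩
  1- (q *L q^ n)                  ≈⟨ 1--cong (q^-+ 1 n) ⟩
  1- q^ (suc n)                   ≈⟨ *-identityʳ _ ⟨
  1- q^ (suc n) *L 1L             ≈⟨ *-congˡ (1- q^ (suc n)) (qbin-0 (suc n)) ⟨
  1- q^ (suc n) *L qbin (suc n) 0 ∎
  where
  open ≋-Reasoning
  q = q^ 1
  expand : ∀ A Y → (1L +L -L A) *L (1L +L A *L Y) ≋ (1L +L -L A) +L A *L ((1L +L -L A) *L Y)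
  expand = solve-∀ laurentSolverRing
  collect : ∀ A B → (1L +L -L A) +L A *L ((1L +L -L B) *L 1L) ≋ 1L +L -L (A *L B)
  collect = solve-∀ laurentSolverRing
qbin-absorb-lower (suc n) (suc k) = begin
  1- A *L qbin (suc n) (suc (suc k)) ≈⟨ *-congˡ (1- A) (qbin-pascal n (suc k)) ⟩
  1- A *L (Y +L A *L Z)              ≈⟨ expand A Y Z ⟩
  1- A *L Y +L A *L (1- A *L Z)      ≈⟨ +-congˡ (1- A *L Y) (*-congˡ A (qbin-absorb-lower n (suc k))) ⟩
  1- A *L Y +L A *L (1- B *L Y)      ≈⟨ collect A B Y ⟩
  Y +L -L ((A *L B) *L Y)            ≈⟨ exponents ⟩
  Y +L -L ((C *L D) *L Y)            ≈⟨ split C D Y ⟨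
  1- C *L Y +L (C *L Y +L -L ((C *L D) *L Y))
    ≈⟨ +-congʳ (C *L Y +L -L ((C *L D) *L Y)) (qbin-absorb-lower n k) ⟩
  1- D *L X +L (C *L Y +L -L ((C *L D) *L Y)) ≈⟨ regroup D X C Y ⟩
  1- D *L (X +L C *L Y)              ≈⟨ *-congˡ (1- D) (qbin-pascal n k) ⟨
  1- D *L qbin (suc n) (suc k)       ∎
  where
  open ≋-Reasoning
  A = q^ (suc (suc k))
  B = q^ (n ∸ suc k)
  C = q^ (suc k)
  D = q^ (n ∸ k)
  X = qbin n k
  Y = qbin n (suc k)
  Z = qbin n (suc (suc k))
  expand : ∀ A Y Z → (1L +L -L A) *L (Y +L A *L Z) ≋ (1L +L -L A) *L Y +L A *L ((1L +L -L A) *L Z)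
  expand = solve-∀ laurentSolverRing
  collect : ∀ A B Y → (1L +L -L A) *L Y +L A *L ((1L +L -L B) *L Y) ≋ Y +L -L ((A *L B) *L Y)
  collect = solve-∀ laurentSolverRing
  split : ∀ C D Y → (1L +L -L C) *L Y +L (C *L Y +L -L ((C *L D) *L Y)) ≋ Y +L -L ((C *L D) *L Y)
  split = solve-∀ laurentSolverRing
  regroup : ∀ D X C Y → (1L +L -L D) *L X +L (C *L Y +L -L ((C *L D) *L Y)) ≋ (1L +L -L D) *L (X +L C *L Y)
  regroup = solve-∀ laurentSolverRing
  -- q^{k+2} q^{n-k-1} = q^{k+1} q^{n-k} when k < n; otherwise Y = [n k+1] = 0
  exponents : Y +L -L ((A *L B) *L Y) ≋ Y +L -L ((C *L D) *L Y)
  exponents with k ℕP.<? n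
  ... | yes k<n = +-congˡ Y (-L-cong (*-congʳ Y (≋-trans (q^-+ (suc (suc k)) (n ∸ suc k))
                    (≋-trans (≋-reflexive (cong q^ same-exponent)) (≋-sym (q^-+ (suc k) (n ∸ k)))))))
    where
    same-exponent : suc (suc k) ℕ.+ (n ∸ suc k) ≡ suc k ℕ.+ (n ∸ k)
    same-exponent = trans (sym (ℕP.+-suc (suc k) (n ∸ suc k))) (cong (suc k ℕ.+_) (sym (ℕP.+-∸-assoc 1 k<n)))
  ... | no k≮n = ≋-trans (+L-cong Y≋0 (-L-cong (*-vanishʳ (A *L B) Y≋0)))
                   (≋-sym (+L-cong Y≋0 (-L-cong (*-vanishʳ (C *L D) Y≋0))))
    where
    Y≋0 : Y ≋ 0L
    Y≋0 = qbin-vanish n (suc k) (ℕP.≤-<-trans (ℕP.≮⇒≥ k≮n) (ℕP.n<1+n k))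

qbin-absorb : ∀ n k → 1- q^ (suc k) *L qbin (suc n) (suc k) ≋ 1- q^ (suc n) *L qbin n k
qbin-absorb n k = begin
  1- C *L qbin (suc n) (suc k)  ≈⟨ *-congˡ (1- C) (qbin-pascal n k) ⟩
  1- C *L (X +L C *L Y)         ≈⟨ expand C X Y ⟩
  1- C *L X +L C *L (1- C *L Y) ≈⟨ +-congˡ (1- C *L X) (*-congˡ C (qbin-absorb-lower n k)) ⟩
  1- C *L X +L C *L (1- D *L X) ≈⟨ collect C D X ⟩
  X +L -L ((C *L D) *L X)       ≈⟨ exponents ⟩
  X +L -L (N *L X)              ≈⟨ factor X N ⟩
  1- N *L X                     ∎
  where
  open ≋-Reasoning
  C = q^ (suc k)
  D = q^ (n ∸ k)
  N = q^ (suc n)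
  X = qbin n k
  Y = qbin n (suc k)
  expand : ∀ C X Y → (1L +L -L C) *L (X +L C *L Y) ≋ (1L +L -L C) *L X +L C *L ((1L +L -L C) *L Y)
  expand = solve-∀ laurentSolverRing
  collect : ∀ A B Y → (1L +L -L A) *L Y +L A *L ((1L +L -L B) *L Y) ≋ Y +L -L ((A *L B) *L Y)
  collect = solve-∀ laurentSolverRing
  factor : ∀ X Y → X +L -L (Y *L X) ≋ (1L +L -L Y) *L X
  factor = solve-∀ laurentSolverRing
  -- q^{k+1} q^{n-k} = q^{n+1} when k ≤ n; otherwise X = [n k] = 0
  exponents : X +L -L ((C *L D) *L X) ≋ X +L -L (N *L X)
  exponents with k ℕP.≤? n
  ... | yes k≤n = +-congˡ X (-L-cong (*-congʳ X (≋-trans (q^-+ (suc k) (n ∸ k))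
                    (≋-reflexive (cong (λ t → q^ (suc t)) (ℕP.m+[n∸m]≡n k≤n))))))
  ... | no k≰n = ≋-trans (+L-cong X≋0 (-L-cong (*-vanishʳ (C *L D) X≋0)))
                   (≋-sym (+L-cong X≋0 (-L-cong (*-vanishʳ N X≋0))))
    where
    X≋0 : X ≋ 0L
    X≋0 = qbin-vanish n k (ℕP.≰⇒> k≰n)

qbin-absorb-+ : ∀ k i → 1- q^ (suc i) *L qbin (k ℕ.+ suc i) (suc i) ≋ 1- q^ (suc (k ℕ.+ i)) *L qbin (k ℕ.+ i) i
qbin-absorb-+ k i = ≋-trans (*-congˡ (1- q^ (suc i)) (≋-reflexive (cong (λ t → qbin t (suc i)) (ℕP.+-suc k i))))
                            (qbin-absorb (k ℕ.+ i) i)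

1-q^-constant-one : ∀ s → ConstantTermOne (1- q^ (suc s))
1-q^-constant-one s = map ℤ.-_ (shiftP s (1ℤ ∷ [])) , ⟪ (λ z → begin
  coeff (1L +L -L q^ (suc s)) z                     ≡⟨ coeff-+L 1L (-L q^ (suc s)) z ⟩
  coeff 1L z ℤ.+ coeff (-L q^ (suc s)) z
    ≡⟨ cong₂ ℤ._+_ (coeff-mkL 0ℤ (1ℤ ∷ []) z) (trans (coeff--L (q^ (suc s)) z) (cong ℤ.-_ (monomial z))) ⟩
  coeffAt (1ℤ ∷ []) (z ℤ.- 0ℤ) ℤ.+ ℤ.- coeffAt (shiftP (suc s) (1ℤ ∷ [])) (z ℤ.- 0ℤ)
    ≡⟨ cong (λ t → coeffAt (1ℤ ∷ []) (z ℤ.- 0ℤ) ℤ.+ t) (coeffAt-negate (shiftP (suc s) (1ℤ ∷ [])) (z ℤ.- 0ℤ)) ⟨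
  coeffAt (1ℤ ∷ []) (z ℤ.- 0ℤ) ℤ.+ coeffAt (map ℤ.-_ (shiftP (suc s) (1ℤ ∷ []))) (z ℤ.- 0ℤ)
    ≡⟨ coeffAt-+P (1ℤ ∷ []) (map ℤ.-_ (shiftP (suc s) (1ℤ ∷ []))) (z ℤ.- 0ℤ) ⟨
  coeffAt ((1ℤ ∷ []) +P map ℤ.-_ (shiftP (suc s) (1ℤ ∷ []))) (z ℤ.- 0ℤ)
    ≡⟨ coeff-mkL 0ℤ (1ℤ ∷ map ℤ.-_ (shiftP s (1ℤ ∷ []))) z ⟨
  coeff (mkL 0ℤ (1ℤ ∷ map ℤ.-_ (shiftP s (1ℤ ∷ [])))) z ∎) ⟫
  where
  open Eq.≡-Reasoning
  monomial : ∀ z → coeff (q^ (suc s)) z ≡ coeffAt (shiftP (suc s) (1ℤ ∷ [])) (z ℤ.- 0ℤ)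
  monomial z = trans (coeff-mkL (+ suc s) (1ℤ ∷ []) z) (trans
    (cong (λ w → coeffAt (1ℤ ∷ []) (w ℤ.- + suc s)) (sym (ℤP.+-identityʳ z)))
    (sym (coeffAt-shift (suc s) (1ℤ ∷ []) (z ℤ.- 0ℤ))))

qbin-constant-term : ∀ n k → k ≤ n → coeffP (qbinP n k) 0 ≡ 1ℤ
qbin-constant-term zero zero _ = refl
qbin-constant-term (suc n) zero _ = refl
qbin-constant-term (suc n) (suc k) (ℕ.s≤s k≤n) =
  trans (coeffP-+P (qbinP n k) (shiftP (suc k) (qbinP n (suc k))) 0)
        (trans (ℤP.+-identityʳ _) (qbin-constant-term n k k≤n))

qbin-constant-one : ∀ n k → k ≤ n → ConstantTermOne (qbin n k)
qbin-constant-one n k k≤n with qbinP n k | qbin-constant-term n k k≤n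
... | x ∷ ps | refl = ps , ≋-refl

-- The basis h k n = q^{-kn} [n k] [n+k k] and its three-term recurrence.

h : ℕ → ℕ → Laurent
h k n = qˆ (ℤ.- + (n ℕ.* k)) *L qbin n k *L qbin (n ℕ.+ k) k

-- σ n = q^{-n} + q^{n+1}; the recurrence multiplies by σ n - σ k.
σ : ℕ → Laurent
σ n = qˆ (ℤ.- + n) +L q^ (suc n)

h-vanish : ∀ k n → n < k → h k n ≋ 0L
h-vanish k n n<k = *-vanishˡ (qbin (n ℕ.+ k) k) (*-vanishʳ (qˆ (ℤ.- + (n ℕ.* k))) (qbin-vanish n k n<k))

h-zero : ∀ n → h 0 n ≋ 1L
h-zero n = ≋-trans (*L-cong (*L-cong (qˆ-cong (cong (λ t → ℤ.- + t) (ℕP.*-zeroʳ n))) (qbin-0 n)) (qbin-0 (n ℕ.+ 0)))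
                   (≋-trans (*-identityʳ (1L *L 1L)) (*-identityʳ 1L))

h-diagonal : ∀ i → h i i ≋ qˆ (ℤ.- + (i ℕ.* i)) *L qbin (i ℕ.+ i) i
h-diagonal i = *-congʳ (qbin (i ℕ.+ i) i) (≋-trans (*-congˡ (qˆ (ℤ.- + (i ℕ.* i))) (qbin-diagonal i))
                                                    (*-identityʳ (qˆ (ℤ.- + (i ℕ.* i)))))

σ-difference : ∀ a b → b ≤ a →
  qˆ (ℤ.- + a) *L 1- q^ (a ∸ b) *L 1- q^ (suc (a ℕ.+ b)) ≋ σ a +L -L σ b
σ-difference a b b≤a = begin
  W *L 1- q^ (a ∸ b) *L 1- q^ (suc (a ℕ.+ b))
    ≈⟨ expand W (q^ (a ∸ b)) (q^ (suc (a ℕ.+ b))) ⟩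
  W +L -L (W *L q^ (a ∸ b)) +L -L (W *L q^ (suc (a ℕ.+ b))) +L (W *L q^ (a ∸ b)) *L q^ (suc (a ℕ.+ b))
    ≈⟨ +L-cong (+L-cong (+-congˡ W (-L-cong Wu)) (-L-cong Wv)) Wuv ⟩
  W +L -L qˆ (ℤ.- + b) +L -L q^ (suc b) +L q^ (suc a) ≈⟨ regroup W (qˆ (ℤ.- + b)) (q^ (suc b)) (q^ (suc a)) ⟩
  σ a +L -L σ b ∎
  where
  open ≋-Reasoning
  W = qˆ (ℤ.- + a)
  expand : ∀ w u v → w *L (1L +L -L u) *L (1L +L -L v) ≋ w +L -L (w *L u) +L -L (w *L v) +L (w *L u) *L v
  expand = solve-∀ laurentSolverRing
  regroup : ∀ w x y z → w +L -L x +L -L y +L z ≋ (w +L z) +L -L (x +L y)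
  regroup = solve-∀ laurentSolverRing
  exp-u : ∀ a b → ℤ.- a ℤ.+ (a ℤ.- b) ≡ ℤ.- b
  exp-u = ℤSolver.solve-∀
  exp-v : ∀ a b → ℤ.- a ℤ.+ (1ℤ ℤ.+ a ℤ.+ b) ≡ 1ℤ ℤ.+ b
  exp-v = ℤSolver.solve-∀
  exp-uv : ∀ a b → ℤ.- b ℤ.+ (1ℤ ℤ.+ a ℤ.+ b) ≡ 1ℤ ℤ.+ a
  exp-uv = ℤSolver.solve-∀
  Wu : W *L q^ (a ∸ b) ≋ qˆ (ℤ.- + b)
  Wu = ≋-trans (qˆ-+ (ℤ.- + a) (+ (a ∸ b)))
    (qˆ-cong (trans (cong (λ t → ℤ.- + a ℤ.+ t) (trans (sym (ℤP.⊖-≥ b≤a)) (sym (ℤP.m-n≡m⊖n a b))))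
                    (exp-u (+ a) (+ b))))
  Wv : W *L q^ (suc (a ℕ.+ b)) ≋ q^ (suc b)
  Wv = ≋-trans (qˆ-+ (ℤ.- + a) (+ suc (a ℕ.+ b))) (qˆ-cong (exp-v (+ a) (+ b)))
  Wuv : (W *L q^ (a ∸ b)) *L q^ (suc (a ℕ.+ b)) ≋ q^ (suc a)
  Wuv = ≋-trans (*-congʳ (q^ (suc (a ℕ.+ b))) Wu)
    (≋-trans (qˆ-+ (ℤ.- + b) (+ suc (a ℕ.+ b))) (qˆ-cong (exp-uv (+ a) (+ b))))

h-recurrence : ∀ k n → 1- q^ (suc k) *L 1- q^ (suc k) *L h (suc k) n ≋ (σ n +L -L σ k) *L h k n
h-recurrence k n with k ℕP.≤? n
... | no k≰n = ≋-trans (*-vanishʳ (1- q^ (suc k) *L 1- q^ (suc k)) (h-vanish (suc k) n (ℕP.m<n⇒m<1+n (ℕP.≰⇒> k≰n))))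
                       (≋-sym (*-vanishʳ (σ n +L -L σ k) (h-vanish k n (ℕP.≰⇒> k≰n))))
... | yes k≤n = begin
  C *L C *L (E *L A₁ *L B₁)                 ≈⟨ distribute C E A₁ B₁ ⟩
  E *L (C *L A₁) *L (C *L B₁)
    ≈⟨ *L-cong (*L-cong E≋ (qbin-absorb-lower n k))
               (qbin-absorb-+ n k) ⟩
  (W *L E₀) *L (U *L A₀) *L (V *L B₀)       ≈⟨ collect W E₀ U A₀ V B₀ ⟩
  (W *L U *L V) *L h k n                    ≈⟨ *-congʳ (h k n) (σ-difference n k k≤n) ⟩
  (σ n +L -L σ k) *L h k n                  ∎
  where
  open ≋-Reasoning
  C = 1- q^ (suc k)
  E = qˆ (ℤ.- + (n ℕ.* suc k))
  E₀ = qˆ (ℤ.- + (n ℕ.* k))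
  W = qˆ (ℤ.- + n)
  A₁ = qbin n (suc k)
  B₁ = qbin (n ℕ.+ suc k) (suc k)
  A₀ = qbin n k
  B₀ = qbin (n ℕ.+ k) k
  U = 1- q^ (n ∸ k)
  V = 1- q^ (suc (n ℕ.+ k))
  distribute : ∀ C E A B → C *L C *L (E *L A *L B) ≋ E *L (C *L A) *L (C *L B)
  distribute = solve-∀ laurentSolverRing
  collect : ∀ W E U A V B → (W *L E) *L (U *L A) *L (V *L B) ≋ (W *L U *L V) *L (E *L A *L B)
  collect = solve-∀ laurentSolverRing
  E≋ : E ≋ W *L E₀
  E≋ = ≋-trans (qˆ-cong (trans (cong (λ t → ℤ.- + t) (ℕP.*-suc n k)) (ℤP.neg-distrib-+ (+ n) (+ (n ℕ.* k)))))
               (≋-sym (qˆ-+ (ℤ.- + n) (ℤ.- + (n ℕ.* k))))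

-- Linearization coefficients
--   c k i j = q^{(j-i)(j+k)} [k+i i] [k i-j] [k+j j],
-- the coefficients of the recursion defining P.

c : ℕ → ℕ → ℕ → Laurent
c k i j = qˆ ((+ j ℤ.- + i) ℤ.* + (j ℕ.+ k)) *L qbin (k ℕ.+ i) i *L qbinℤ k (+ i ℤ.- + j) *L qbin (k ℕ.+ j) j

c⁺ : ℕ → ℕ → ℕ → ℕ → Laurent
c⁺ k i j t = qˆ (ℤ.- (+ t ℤ.* + (j ℕ.+ k))) *L qbin (k ℕ.+ i) i *L qbin k t *L qbin (k ℕ.+ j) j

c≋c⁺ : ∀ k i j t → i ≡ t ℕ.+ j → c k i j ≋ c⁺ k i j t
c≋c⁺ k .(t ℕ.+ j) j t refl =
  *-congʳ (qbin (k ℕ.+ j) j) (*L-cong (*-congʳ (qbin (k ℕ.+ (t ℕ.+ j)) (t ℕ.+ j)) (qˆ-cong (exponent (+ t) (+ j) (+ (j ℕ.+ k)))))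
                                      (≋-reflexive (cong (qbinℤ k) (difference (+ t) (+ j)))))
  where
  exponent : ∀ t j x → (j ℤ.- (t ℤ.+ j)) ℤ.* x ≡ ℤ.- (t ℤ.* x)
  exponent = ℤSolver.solve-∀
  difference : ∀ t j → (t ℤ.+ j) ℤ.- j ≡ t
  difference = ℤSolver.solve-∀

c⁺-vanish : ∀ k i j t → qbin k t ≋ 0L → c⁺ k i j t ≋ 0L
c⁺-vanish k i j t [k,t]≋0 =
  *-vanishˡ (qbin (k ℕ.+ j) j) (*-vanishʳ (qˆ (ℤ.- (+ t ℤ.* + (j ℕ.+ k))) *L qbin (k ℕ.+ i) i) [k,t]≋0)

-- c k i j = 0 for j > i, since then [k i-j] = 0.
c-vanish : ∀ k i j → i < j → c k i j ≋ 0L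
c-vanish k i j i<j = subst (λ j → c k i j ≋ 0L) (trans (ℕP.+-suc i t) (ℕP.m+[n∸m]≡n i<j))
  (*-vanishˡ (qbin (k ℕ.+ (i ℕ.+ suc t)) (i ℕ.+ suc t))
    (*-vanishʳ (qˆ ((+ (i ℕ.+ suc t) ℤ.- + i) ℤ.* + ((i ℕ.+ suc t) ℕ.+ k)) *L qbin (k ℕ.+ i) i)
      (≋-reflexive (cong (qbinℤ k) (negative (+ i) (+ t))))))
  where
  t = j ∸ suc i
  negative : ∀ i t → i ℤ.- (i ℤ.+ (1ℤ ℤ.+ t)) ≡ ℤ.- (1ℤ ℤ.+ t)
  negative = ℤSolver.solve-∀

-- The recurrence satisfied by the coefficients in the index i; together with
-- the recurrence of h it drives the induction proving linearization.
CRecurrence : ℕ → ℕ → ℕ → Set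
CRecurrence k i j =
  1- q^ (suc i) *L 1- q^ (suc i) *L c k (suc i) (suc j)
  ≋ c k i j *L (1- q^ (suc (k ℕ.+ j)) *L 1- q^ (suc (k ℕ.+ j))) +L c k i (suc j) *L (σ (k ℕ.+ suc j) +L -L σ i)

c-recurrence-0 : ∀ k i → 1- q^ (suc i) *L 1- q^ (suc i) *L c k (suc i) 0 ≋ c k i 0 *L (σ (k ℕ.+ 0) +L -L σ i)
c-recurrence-0 k i with ℕP.<-cmp i k
... | tri< i<k _ _ = begin
  m *L m *L c k (suc i) 0 ≈⟨ *-congˡ (m *L m) (c≋c⁺ k (suc i) 0 (suc i) (sym (ℕP.+-identityʳ (suc i)))) ⟩
  m *L m *L (x *L A' *L K₁ *L B) ≈⟨ distribute m x A' K₁ B ⟩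
  x *L (m *L A') *L (m *L K₁) *L B
    ≈⟨ *-congʳ B (*L-cong (*L-cong x≋ (qbin-absorb-+ k i)) (qbin-absorb-lower k i)) ⟩
  (y *L w) *L (V *L A) *L (U *L K₀) *L B ≈⟨ collect y w V A U K₀ B ⟩
  (y *L A *L K₀ *L B) *L (w *L U *L V)
    ≈⟨ *L-cong (≋-sym (c≋c⁺ k i 0 i (sym (ℕP.+-identityʳ i))))
               (≋-trans (σ-difference k i (ℕP.<⇒≤ i<k)) (≋-reflexive (cong (λ t → σ t +L -L σ i) (sym (ℕP.+-identityʳ k))))) ⟩
  c k i 0 *L (σ (k ℕ.+ 0) +L -L σ i) ∎
  where
  open ≋-Reasoning
  m = 1- q^ (suc i)
  x = qˆ (ℤ.- (+ suc i ℤ.* + (0 ℕ.+ k)))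
  y = qˆ (ℤ.- (+ i ℤ.* + (0 ℕ.+ k)))
  w = qˆ (ℤ.- + k)
  A' = qbin (k ℕ.+ suc i) (suc i)
  A = qbin (k ℕ.+ i) i
  K₁ = qbin k (suc i)
  K₀ = qbin k i
  B = qbin (k ℕ.+ 0) 0
  U = 1- q^ (k ∸ i)
  V = 1- q^ (suc (k ℕ.+ i))
  distribute : ∀ m x A K B → m *L m *L (x *L A *L K *L B) ≋ x *L (m *L A) *L (m *L K) *L B
  distribute = solve-∀ laurentSolverRing
  collect : ∀ y w V A U K B → (y *L w) *L (V *L A) *L (U *L K) *L B ≋ (y *L A *L K *L B) *L (w *L U *L V)
  collect = solve-∀ laurentSolverRing
  exponent : ∀ i k → ℤ.- ((1ℤ ℤ.+ i) ℤ.* k) ≡ ℤ.- (i ℤ.* k) ℤ.+ ℤ.- k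
  exponent = ℤSolver.solve-∀
  x≋ : x ≋ y *L w
  x≋ = ≋-trans (qˆ-cong (exponent (+ i) (+ k))) (≋-sym (qˆ-+ (ℤ.- (+ i ℤ.* + k)) (ℤ.- + k)))
... | tri≈ _ refl _ = ≋-trans
  (*-vanishʳ (1- q^ (suc i) *L 1- q^ (suc i)) (≋-trans (c≋c⁺ i (suc i) 0 (suc i) (sym (ℕP.+-identityʳ (suc i))))
                                                      (c⁺-vanish i (suc i) 0 (suc i) (qbin-vanish i (suc i) (ℕP.n<1+n i)))))
  (≋-sym (*-vanishʳ (c i i 0) (≋-trans (≋-reflexive (cong (λ t → σ t +L -L σ i) (ℕP.+-identityʳ i)))
                                       (-‿inverseʳ (σ i)))))
... | tri> _ _ k<i = ≋-trans
  (*-vanishʳ (1- q^ (suc i) *L 1- q^ (suc i)) (≋-trans (c≋c⁺ k (suc i) 0 (suc i) (sym (ℕP.+-identityʳ (suc i))))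
                                                      (c⁺-vanish k (suc i) 0 (suc i) (qbin-vanish k (suc i) (ℕP.m<n⇒m<1+n k<i)))))
  (≋-sym (*-vanishˡ (σ (k ℕ.+ 0) +L -L σ i) (≋-trans (c≋c⁺ k i 0 i (sym (ℕP.+-identityʳ i)))
                                                     (c⁺-vanish k i 0 i (qbin-vanish k i k<i)))))

-- Products of monomials, used to normalise the exponents in the generic
-- case of the coefficient recurrence.

qˆΠ : List ℤ → Laurent
qˆΠ = foldr (λ x p → qˆ x *L p) 1L

Σℤ : List ℤ → ℤ
Σℤ = foldr ℤ._+_ 0ℤ

qˆΠ≋ : ∀ xs → qˆΠ xs ≋ qˆ (Σℤ xs)
qˆΠ≋ [] = ≋-refl
qˆΠ≋ (x ∷ xs) = ≋-trans (*-congˡ (qˆ x) (qˆΠ≋ xs)) (qˆ-+ x (Σℤ xs))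

qˆ-split : ∀ base {z} xs → z ≡ base ℤ.+ Σℤ xs → qˆ z ≋ qˆ base *L qˆΠ xs
qˆ-split base xs z≡ = ≋-trans (qˆ-cong z≡) (≋-sym (≋-trans (*-congˡ (qˆ base) (qˆΠ≋ xs)) (qˆ-+ base (Σℤ xs))))

1-q^-as-Π : ∀ {n} xs → + n ≡ Σℤ xs → 1- q^ n ≋ 1- qˆΠ xs
1-q^-as-Π xs n≡ = 1--cong (≋-trans (qˆ-cong n≡) (≋-sym (qˆΠ≋ xs)))

-- The scalar identity behind the generic case of the recurrence
-- (k = d + e, i = j + d + 1): after every monomial is written as
-- q^{-(d+1)(j+1+k)} times a product of q^d, q^e, q^j and q, it is a
-- polynomial identity in those four quantities.
c-recurrence-scalar : ∀ j d e →
  let k = d ℕ.+ e ; i = suc (j ℕ.+ d) in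
  qˆ (ℤ.- (+ suc d ℤ.* + (suc j ℕ.+ k))) *L 1- q^ (suc i) *L 1- q^ (suc (k ℕ.+ i)) *L 1- q^ e
  ≋ qˆ (ℤ.- (+ suc d ℤ.* + (j ℕ.+ k))) *L 1- q^ e *L 1- q^ (suc j) *L 1- q^ (suc (k ℕ.+ j))
    +L 1- q^ (suc d) *L (qˆ (ℤ.- (+ d ℤ.* + (suc j ℕ.+ k))) *L (σ (k ℕ.+ suc j) +L -L σ i))
c-recurrence-scalar j d e = begin
  x₁ *L 1- q^ (suc i) *L 1- q^ (suc (k ℕ.+ i)) *L 1- q^ e
    ≈⟨ *L-cong (*L-cong (*-congˡ x₁ (1-q^-as-Π (pj ∷ pd ∷ 1ℤ ∷ 1ℤ ∷ []) (exp-i pj pd)))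
                                    (1-q^-as-Π (pd ∷ pd ∷ pe ∷ pj ∷ 1ℤ ∷ 1ℤ ∷ []) (exp-k+i pd pe pj)))
               (1-q^-as-Π (pe ∷ []) (exp-e pe)) ⟩
  _ ≈⟨ polynomial-identity x₁ (q^ d) (q^ e) (q^ j) (q^ 1) ⟩
  _ ≈⟨ +L-cong (*L-cong (*L-cong (*L-cong (qˆ-split x₁e (pd ∷ 1ℤ ∷ []) (exp-x₂ pd pe pj))
                                           (1-q^-as-Π (pe ∷ []) (exp-e pe)))
                                 (1-q^-as-Π (pj ∷ 1ℤ ∷ []) (exp-1+ pj)))
                       (1-q^-as-Π (pd ∷ pe ∷ pj ∷ 1ℤ ∷ []) (exp-k+j pd pe pj)))
               (*L-cong (1-q^-as-Π (pd ∷ 1ℤ ∷ []) (exp-1+ pd)) x₃D≋) ⟨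
  x₂ *L 1- q^ e *L 1- q^ (suc j) *L 1- q^ (suc (k ℕ.+ j)) +L 1- q^ (suc d) *L (x₃ *L D) ∎
  where
  open ≋-Reasoning
  k = d ℕ.+ e
  i = suc (j ℕ.+ d)
  pd = + d
  pe = + e
  pj = + j
  x₁e = ℤ.- (+ suc d ℤ.* + (suc j ℕ.+ k))
  x₃e = ℤ.- (+ d ℤ.* + (suc j ℕ.+ k))
  x₁ = qˆ x₁e
  x₂ = qˆ (ℤ.- (+ suc d ℤ.* + (j ℕ.+ k)))
  x₃ = qˆ x₃e
  D = σ (k ℕ.+ suc j) +L -L σ i
  exp-i : ∀ j d → 1ℤ ℤ.+ (1ℤ ℤ.+ (j ℤ.+ d)) ≡ j ℤ.+ (d ℤ.+ (1ℤ ℤ.+ (1ℤ ℤ.+ 0ℤ)))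
  exp-i = ℤSolver.solve-∀
  exp-k+i : ∀ d e j → 1ℤ ℤ.+ ((d ℤ.+ e) ℤ.+ (1ℤ ℤ.+ (j ℤ.+ d))) ≡ d ℤ.+ (d ℤ.+ (e ℤ.+ (j ℤ.+ (1ℤ ℤ.+ (1ℤ ℤ.+ 0ℤ)))))
  exp-k+i = ℤSolver.solve-∀
  exp-e : ∀ e → e ≡ e ℤ.+ 0ℤ
  exp-e = ℤSolver.solve-∀
  exp-1+ : ∀ j → 1ℤ ℤ.+ j ≡ j ℤ.+ (1ℤ ℤ.+ 0ℤ)
  exp-1+ = ℤSolver.solve-∀
  exp-k+j : ∀ d e j → 1ℤ ℤ.+ ((d ℤ.+ e) ℤ.+ j) ≡ d ℤ.+ (e ℤ.+ (j ℤ.+ (1ℤ ℤ.+ 0ℤ)))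
  exp-k+j = ℤSolver.solve-∀
  exp-x₂ : ∀ d e j → ℤ.- ((1ℤ ℤ.+ d) ℤ.* (j ℤ.+ (d ℤ.+ e)))
                     ≡ ℤ.- ((1ℤ ℤ.+ d) ℤ.* ((1ℤ ℤ.+ j) ℤ.+ (d ℤ.+ e))) ℤ.+ (d ℤ.+ (1ℤ ℤ.+ 0ℤ))
  exp-x₂ = ℤSolver.solve-∀
  exp-a : ∀ d e j → ℤ.- (d ℤ.* ((1ℤ ℤ.+ j) ℤ.+ (d ℤ.+ e))) ℤ.+ ℤ.- ((d ℤ.+ e) ℤ.+ (1ℤ ℤ.+ j))
                    ≡ ℤ.- ((1ℤ ℤ.+ d) ℤ.* ((1ℤ ℤ.+ j) ℤ.+ (d ℤ.+ e))) ℤ.+ 0ℤ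
  exp-a = ℤSolver.solve-∀
  exp-b : ∀ d e j → ℤ.- (d ℤ.* ((1ℤ ℤ.+ j) ℤ.+ (d ℤ.+ e))) ℤ.+ (1ℤ ℤ.+ ((d ℤ.+ e) ℤ.+ (1ℤ ℤ.+ j)))
                    ≡ ℤ.- ((1ℤ ℤ.+ d) ℤ.* ((1ℤ ℤ.+ j) ℤ.+ (d ℤ.+ e)))
                      ℤ.+ (d ℤ.+ (d ℤ.+ (e ℤ.+ (e ℤ.+ (j ℤ.+ (j ℤ.+ (1ℤ ℤ.+ (1ℤ ℤ.+ (1ℤ ℤ.+ 0ℤ)))))))))
  exp-b = ℤSolver.solve-∀
  exp-c : ∀ d e j → ℤ.- (d ℤ.* ((1ℤ ℤ.+ j) ℤ.+ (d ℤ.+ e))) ℤ.+ ℤ.- (1ℤ ℤ.+ (j ℤ.+ d))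
                    ≡ ℤ.- ((1ℤ ℤ.+ d) ℤ.* ((1ℤ ℤ.+ j) ℤ.+ (d ℤ.+ e))) ℤ.+ (e ℤ.+ 0ℤ)
  exp-c = ℤSolver.solve-∀
  exp-d : ∀ d e j → ℤ.- (d ℤ.* ((1ℤ ℤ.+ j) ℤ.+ (d ℤ.+ e))) ℤ.+ (1ℤ ℤ.+ (1ℤ ℤ.+ (j ℤ.+ d)))
                    ≡ ℤ.- ((1ℤ ℤ.+ d) ℤ.* ((1ℤ ℤ.+ j) ℤ.+ (d ℤ.+ e)))
                      ℤ.+ (d ℤ.+ (d ℤ.+ (e ℤ.+ (j ℤ.+ (j ℤ.+ (1ℤ ℤ.+ (1ℤ ℤ.+ (1ℤ ℤ.+ 0ℤ))))))))
  exp-d = ℤSolver.solve-∀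
  polynomial-identity : ∀ X a b g q →
    X *L (1L +L -L (g *L (a *L (q *L (q *L 1L))))) *L (1L +L -L (a *L (a *L (b *L (g *L (q *L (q *L 1L)))))))
      *L (1L +L -L (b *L 1L))
    ≋ (X *L (a *L (q *L 1L))) *L (1L +L -L (b *L 1L)) *L (1L +L -L (g *L (q *L 1L)))
        *L (1L +L -L (a *L (b *L (g *L (q *L 1L)))))
      +L (1L +L -L (a *L (q *L 1L)))
         *L ((X *L 1L +L X *L (a *L (a *L (b *L (b *L (g *L (g *L (q *L (q *L (q *L 1L))))))))))
             +L -L (X *L (b *L 1L) +L X *L (a *L (a *L (b *L (g *L (g *L (q *L (q *L (q *L 1L))))))))))
  polynomial-identity = solve-∀ laurentSolverRing
  distribute : ∀ x A B C E → x *L ((A +L B) +L -L (C +L E)) ≋ (x *L A +L x *L B) +L -L (x *L C +L x *L E)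
  distribute = solve-∀ laurentSolverRing
  shifted : ∀ m xs → x₃e ℤ.+ m ≡ x₁e ℤ.+ Σℤ xs → x₃ *L qˆ m ≋ x₁ *L qˆΠ xs
  shifted m xs eq = ≋-trans (qˆ-+ x₃e m) (qˆ-split x₁e xs eq)
  x₃D≋ : x₃ *L D ≋ (x₁ *L qˆΠ [] +L x₁ *L qˆΠ (pd ∷ pd ∷ pe ∷ pe ∷ pj ∷ pj ∷ 1ℤ ∷ 1ℤ ∷ 1ℤ ∷ []))
                   +L -L (x₁ *L qˆΠ (pe ∷ []) +L x₁ *L qˆΠ (pd ∷ pd ∷ pe ∷ pj ∷ pj ∷ 1ℤ ∷ 1ℤ ∷ 1ℤ ∷ []))
  x₃D≋ = ≋-trans (distribute x₃ (qˆ (ℤ.- + (k ℕ.+ suc j))) (q^ (suc (k ℕ.+ suc j))) (qˆ (ℤ.- + i)) (q^ (suc i)))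
    (+L-cong (+L-cong (shifted (ℤ.- + (k ℕ.+ suc j)) [] (exp-a pd pe pj))
                      (shifted (+ suc (k ℕ.+ suc j)) (pd ∷ pd ∷ pe ∷ pe ∷ pj ∷ pj ∷ 1ℤ ∷ 1ℤ ∷ 1ℤ ∷ []) (exp-b pd pe pj)))
             (-L-cong (+L-cong (shifted (ℤ.- + i) (pe ∷ []) (exp-c pd pe pj))
                               (shifted (+ suc i) (pd ∷ pd ∷ pe ∷ pj ∷ pj ∷ 1ℤ ∷ 1ℤ ∷ 1ℤ ∷ []) (exp-d pd pe pj)))))

-- j ≥ i + 1: every coefficient involved vanishes.
c-recurrence-above : ∀ k i j → i < j → CRecurrence k i j
c-recurrence-above k i j i<j = ≋-trans
  (*-vanishʳ (1- q^ (suc i) *L 1- q^ (suc i)) (c-vanish k (suc i) (suc j) (ℕ.s≤s i<j)))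
  (≋-sym (≋-trans (+L-cong (*-vanishˡ (1- q^ (suc (k ℕ.+ j)) *L 1- q^ (suc (k ℕ.+ j))) (c-vanish k i j i<j))
                           (*-vanishˡ (σ (k ℕ.+ suc j) +L -L σ i) (c-vanish k i (suc j) (ℕP.m<n⇒m<1+n i<j))))
                  (+-identityˡ 0L)))

-- j = i: only the leading coefficients survive, and absorption relates them.
c-recurrence-diagonal : ∀ k i → CRecurrence k i i
c-recurrence-diagonal k i = begin
  m *L m *L c k (suc i) (suc i)    ≈⟨ *-congˡ (m *L m) (c≋c⁺ k (suc i) (suc i) 0 refl) ⟩
  m *L m *L (x *L A' *L K *L A')   ≈⟨ distribute m x A' K ⟩
  x *L (m *L A') *L K *L (m *L A') ≈⟨ *L-cong (*-congʳ K (*L-cong x≋y (qbin-absorb-+ k i))) (qbin-absorb-+ k i) ⟩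
  y *L (V *L A) *L K *L (V *L A)   ≈⟨ collect y V A K ⟩
  (y *L A *L K *L A) *L (V *L V)   ≈⟨ *-congʳ (V *L V) (c≋c⁺ k i i 0 refl) ⟨
  c k i i *L (V *L V)              ≈⟨ +-identityʳ (c k i i *L (V *L V)) ⟨
  c k i i *L (V *L V) +L 0L
    ≈⟨ +-congˡ (c k i i *L (V *L V)) (*-vanishˡ (σ (k ℕ.+ suc i) +L -L σ i) (c-vanish k i (suc i) (ℕP.n<1+n i))) ⟨
  c k i i *L (V *L V) +L c k i (suc i) *L (σ (k ℕ.+ suc i) +L -L σ i) ∎
  where
  open ≋-Reasoning
  m = 1- q^ (suc i)
  V = 1- q^ (suc (k ℕ.+ i))
  x = qˆ (ℤ.- (+ 0 ℤ.* + (suc i ℕ.+ k)))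
  y = qˆ (ℤ.- (+ 0 ℤ.* + (i ℕ.+ k)))
  A' = qbin (k ℕ.+ suc i) (suc i)
  A = qbin (k ℕ.+ i) i
  K = qbin k 0
  distribute : ∀ m x A K → m *L m *L (x *L A *L K *L A) ≋ x *L (m *L A) *L K *L (m *L A)
  distribute = solve-∀ laurentSolverRing
  collect : ∀ y V A K → y *L (V *L A) *L K *L (V *L A) ≋ (y *L A *L K *L A) *L (V *L V)
  collect = solve-∀ laurentSolverRing
  -- x and y are both q^0
  x≋y : x ≋ y
  x≋y = ≋-refl

-- j < i, i = j + d + 1 with d ≤ k = d + e: after cancelling 1 - q^{d+1} and
-- using absorption three times, both sides become [k+i i][k d][k+j+1 j+1]
-- times the two sides of the scalar identity.
c-recurrence-generic : ∀ j d e → CRecurrence (d ℕ.+ e) (suc (j ℕ.+ d)) j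
c-recurrence-generic j d e = *L-cancelˡ (1-q^-constant-one d) lhs rhs (begin
  M *L lhs                                 ≈⟨ *-congˡ M (*-congˡ (m *L m) (c≋c⁺ k (suc i) (suc j) (suc d) (shape₁ j d))) ⟩
  M *L (m *L m *L (x₁ *L A' *L K₁ *L B'))   ≈⟨ distribute M m x₁ A' K₁ B' ⟩
  x₁ *L m *L (m *L A') *L (M *L K₁) *L B'   ≈⟨ *-congʳ B' (*L-cong (*-congˡ (x₁ *L m) (qbin-absorb-+ k i)) K₁≋) ⟩
  x₁ *L m *L (V *L A) *L (G *L K₀) *L B'    ≈⟨ factor-out x₁ m V A G K₀ B' ⟩
  (A *L K₀ *L B') *L (x₁ *L m *L V *L G)   ≈⟨ *-congˡ (A *L K₀ *L B') scalar ⟩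
  (A *L K₀ *L B') *L (x₂ *L G *L Pj *L N +L M *L (x₃ *L D)) ≈⟨ factor-in x₂ A G K₀ Pj B' N x₃ M D ⟨
  (x₂ *L A *L (G *L K₀) *L (Pj *L B')) *L N +L (x₃ *L A *L K₀ *L B') *L (M *L D)
    ≈⟨ +-congʳ ((x₃ *L A *L K₀ *L B') *L (M *L D))
         (*-congʳ N (*L-cong (*-congˡ (x₂ *L A) (≋-sym K₁≋)) (qbin-absorb-+ k j))) ⟩
  (x₂ *L A *L (M *L K₁) *L (N *L B)) *L N +L (x₃ *L A *L K₀ *L B') *L (M *L D)
    ≈⟨ distribute-M M x₂ A K₁ B N x₃ K₀ B' D ⟨
  M *L ((x₂ *L A *L K₁ *L B) *L (N *L N) +L (x₃ *L A *L K₀ *L B') *L D)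
    ≈⟨ *-congˡ M (+L-cong (*-congʳ (N *L N) (c≋c⁺ k i j (suc d) (shape₂ j d)))
                          (*-congʳ D (c≋c⁺ k i (suc j) d (shape₃ j d)))) ⟨
  M *L rhs ∎)
  where
  open ≋-Reasoning
  k = d ℕ.+ e
  i = suc (j ℕ.+ d)
  m = 1- q^ (suc i)
  M = 1- q^ (suc d)
  V = 1- q^ (suc (k ℕ.+ i))
  G = 1- q^ e
  Pj = 1- q^ (suc j)
  N = 1- q^ (suc (k ℕ.+ j))
  D = σ (k ℕ.+ suc j) +L -L σ i
  x₁ = qˆ (ℤ.- (+ suc d ℤ.* + (suc j ℕ.+ k)))
  x₂ = qˆ (ℤ.- (+ suc d ℤ.* + (j ℕ.+ k)))
  x₃ = qˆ (ℤ.- (+ d ℤ.* + (suc j ℕ.+ k)))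
  A' = qbin (k ℕ.+ suc i) (suc i)
  A = qbin (k ℕ.+ i) i
  K₁ = qbin k (suc d)
  K₀ = qbin k d
  B' = qbin (k ℕ.+ suc j) (suc j)
  B = qbin (k ℕ.+ j) j
  lhs = m *L m *L c k (suc i) (suc j)
  rhs = c k i j *L (N *L N) +L c k i (suc j) *L D
  shape₁ : ∀ j d → suc (suc (j ℕ.+ d)) ≡ suc d ℕ.+ suc j
  shape₁ = ℕSolver.solve-∀
  shape₂ : ∀ j d → suc (j ℕ.+ d) ≡ suc d ℕ.+ j
  shape₂ = ℕSolver.solve-∀
  shape₃ : ∀ j d → suc (j ℕ.+ d) ≡ d ℕ.+ suc j
  shape₃ = ℕSolver.solve-∀
  K₁≋ : M *L K₁ ≋ G *L K₀
  K₁≋ = ≋-trans (qbin-absorb-lower k d) (*-congʳ K₀ (≋-reflexive (cong (λ t → 1- q^ t) (ℕP.m+n∸m≡n d e))))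
  scalar : x₁ *L m *L V *L G ≋ x₂ *L G *L Pj *L N +L M *L (x₃ *L D)
  scalar = c-recurrence-scalar j d e
  distribute : ∀ M m x A K B → M *L (m *L m *L (x *L A *L K *L B)) ≋ x *L m *L (m *L A) *L (M *L K) *L B
  distribute = solve-∀ laurentSolverRing
  factor-out : ∀ x m V A G K B → x *L m *L (V *L A) *L (G *L K) *L B ≋ (A *L K *L B) *L (x *L m *L V *L G)
  factor-out = solve-∀ laurentSolverRing
  factor-in : ∀ x₂ A G K P B N x₃ M D →
    (x₂ *L A *L (G *L K) *L (P *L B)) *L N +L (x₃ *L A *L K *L B) *L (M *L D)
    ≋ (A *L K *L B) *L (x₂ *L G *L P *L N +L M *L (x₃ *L D))
  factor-in = solve-∀ laurentSolverRing
  distribute-M : ∀ M x₂ A K₁ B N x₃ K₀ B' D →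
    M *L ((x₂ *L A *L K₁ *L B) *L (N *L N) +L (x₃ *L A *L K₀ *L B') *L D)
    ≋ (x₂ *L A *L (M *L K₁) *L (N *L B)) *L N +L (x₃ *L A *L K₀ *L B') *L (M *L D)
  distribute-M = solve-∀ laurentSolverRing

-- j < i, i = j + d + 1 with k < d: the factors [k d] and [k d+1] vanish.
c-recurrence-vanishing : ∀ j d k → k < d → CRecurrence k (suc (j ℕ.+ d)) j
c-recurrence-vanishing j d k k<d = ≋-trans
  (*-vanishʳ (1- q^ (suc i) *L 1- q^ (suc i))
    (≋-trans (c≋c⁺ k (suc i) (suc j) (suc d) (shape₁ j d)) (c⁺-vanish k (suc i) (suc j) (suc d) [k,d+1]≋0)))
  (≋-sym (≋-trans (+L-cong
    (*-vanishˡ (1- q^ (suc (k ℕ.+ j)) *L 1- q^ (suc (k ℕ.+ j)))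
      (≋-trans (c≋c⁺ k i j (suc d) (shape₂ j d)) (c⁺-vanish k i j (suc d) [k,d+1]≋0)))
    (*-vanishˡ (σ (k ℕ.+ suc j) +L -L σ i)
      (≋-trans (c≋c⁺ k i (suc j) d (shape₃ j d)) (c⁺-vanish k i (suc j) d (qbin-vanish k d k<d)))))
    (+-identityˡ 0L)))
  where
  i = suc (j ℕ.+ d)
  [k,d+1]≋0 : qbin k (suc d) ≋ 0L
  [k,d+1]≋0 = qbin-vanish k (suc d) (ℕP.m<n⇒m<1+n k<d)
  shape₁ : ∀ j d → suc (suc (j ℕ.+ d)) ≡ suc d ℕ.+ suc j
  shape₁ = ℕSolver.solve-∀
  shape₂ : ∀ j d → suc (j ℕ.+ d) ≡ suc d ℕ.+ j
  shape₂ = ℕSolver.solve-∀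
  shape₃ : ∀ j d → suc (j ℕ.+ d) ≡ d ℕ.+ suc j
  shape₃ = ℕSolver.solve-∀

c-recurrence : ∀ k i j → CRecurrence k i j
c-recurrence k i j with ℕP.<-cmp j i
... | tri≈ _ refl _ = c-recurrence-diagonal k i
... | tri> _ _ i<j = c-recurrence-above k i j i<j
... | tri< j<i _ _ with i ∸ suc j ℕP.≤? k
...   | yes d≤k = subst₂ (λ k' i' → CRecurrence k' i' j) (ℕP.m+[n∸m]≡n d≤k) (ℕP.m+[n∸m]≡n j<i)
                    (c-recurrence-generic j (i ∸ suc j) (k ∸ (i ∸ suc j)))
...   | no d≰k = subst (λ i' → CRecurrence k i' j) (ℕP.m+[n∸m]≡n j<i)
                   (c-recurrence-vanishing j (i ∸ suc j) k (ℕP.≰⇒> d≰k))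

cancel-square : ∀ s X Y → 1- q^ (suc s) *L 1- q^ (suc s) *L X ≋ 1- q^ (suc s) *L 1- q^ (suc s) *L Y → X ≋ Y
cancel-square s X Y eq = *L-cancelˡ one X Y (*L-cancelˡ one (m *L X) (m *L Y)
  (≋-trans (≋-sym (*-assoc m m X)) (≋-trans eq (*-assoc m m Y))))
  where
  m = 1- q^ (suc s)
  one = 1-q^-constant-one s

-- Multiplying the expansion of h k n · h i n by σ n - σ i yields
-- (1 - q^{i+1})² times the expansion of h k n · h (i+1) n: split
-- σ n - σ i = (σ n - σ (k+j)) + (σ (k+j) - σ i) in the j-th term, apply the
-- recurrence of h to the first part, and regroup with the recurrence of c.
linearization-step : ∀ k i n →
  (σ n +L -L σ i) *L Σ< (suc i) (λ j → c k i j *L h (k ℕ.+ j) n)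
  ≋ 1- q^ (suc i) *L 1- q^ (suc i) *L Σ< (suc (suc i)) (λ j → c k (suc i) j *L h (k ℕ.+ j) n)
linearization-step k i n = begin
  W *L Σ< (suc i) (λ j → c k i j *L h (k ℕ.+ j) n)   ≈⟨ Σ<-*ˡ (suc i) W (λ j → c k i j *L h (k ℕ.+ j) n) ⟩
  Σ< (suc i) (λ j → W *L (c k i j *L h (k ℕ.+ j) n)) ≈⟨ Σ<-cong (suc i) (λ j _ → split j) ⟩
  Σ< (suc i) (λ j → up j +L same j)                   ≈⟨ Σ<-+ (suc i) up same ⟩
  Σ< (suc i) up +L Σ< (suc i) same                   ≈⟨ +-congˡ (Σ< (suc i) up) (Σ<-extend (suc i) (suc (suc i)) same (ℕP.n≤1+n (suc i))
                                                            (λ j i<j j<i+2 → same-vanish j i<j j<i+2)) ⟨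
  Σ< (suc i) up +L (same 0 +L Σ< (suc i) (λ j → same (suc j)))
    ≈⟨ swap-first (Σ< (suc i) up) (same 0) (Σ< (suc i) (λ j → same (suc j))) ⟩
  same 0 +L (Σ< (suc i) up +L Σ< (suc i) (λ j → same (suc j)))
    ≈⟨ +-congˡ (same 0) (Σ<-+ (suc i) up (λ j → same (suc j))) ⟨
  same 0 +L Σ< (suc i) (λ j → up j +L same (suc j))
    ≈⟨ +L-cong first (Σ<-cong (suc i) (λ j _ → later j)) ⟨
  Σ< (suc (suc i)) (λ j → m *L m *L (c k (suc i) j *L h (k ℕ.+ j) n))
    ≈⟨ Σ<-*ˡ (suc (suc i)) (m *L m) (λ j → c k (suc i) j *L h (k ℕ.+ j) n) ⟨
  m *L m *L Σ< (suc (suc i)) (λ j → c k (suc i) j *L h (k ℕ.+ j) n) ∎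
  where
  open ≋-Reasoning
  m = 1- q^ (suc i)
  W = σ n +L -L σ i
  N² : ℕ → Laurent
  N² j = 1- q^ (suc (k ℕ.+ j)) *L 1- q^ (suc (k ℕ.+ j))
  -- the part of the j-th term that moves up to h (k+j+1), and the part that stays
  up same : ℕ → Laurent
  up j = c k i j *L (N² j *L h (suc (k ℕ.+ j)) n)
  same j = c k i j *L ((σ (k ℕ.+ j) +L -L σ i) *L h (k ℕ.+ j) n)
  split-σ : ∀ Z A B c H → (Z +L -L B) *L (c *L H) ≋ c *L ((Z +L -L A) *L H) +L c *L ((A +L -L B) *L H)
  split-σ = solve-∀ laurentSolverRing
  split : ∀ j → W *L (c k i j *L h (k ℕ.+ j) n) ≋ up j +L same j
  split j = ≋-trans (split-σ (σ n) (σ (k ℕ.+ j)) (σ i) (c k i j) (h (k ℕ.+ j) n))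
                    (+-congʳ (same j) (*-congˡ (c k i j) (≋-sym (h-recurrence (k ℕ.+ j) n))))
  same-vanish : ∀ j → suc i ≤ j → j < suc (suc i) → same j ≋ 0L
  same-vanish j i<j _ = *-vanishˡ ((σ (k ℕ.+ j) +L -L σ i) *L h (k ℕ.+ j) n) (c-vanish k i j i<j)
  swap-first : ∀ a b c → a +L (b +L c) ≋ b +L (a +L c)
  swap-first = solve-∀ laurentSolverRing
  reassociate : ∀ m c H → m *L m *L (c *L H) ≋ (m *L m *L c) *L H
  reassociate = solve-∀ laurentSolverRing
  first : m *L m *L (c k (suc i) 0 *L h (k ℕ.+ 0) n) ≋ same 0
  first = ≋-trans (reassociate m (c k (suc i) 0) (h (k ℕ.+ 0) n))
    (≋-trans (*-congʳ (h (k ℕ.+ 0) n) (c-recurrence-0 k i))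
             (*-assoc (c k i 0) (σ (k ℕ.+ 0) +L -L σ i) (h (k ℕ.+ 0) n)))
  distribute : ∀ c NN c' D H → (c *L NN +L c' *L D) *L H ≋ c *L (NN *L H) +L c' *L (D *L H)
  distribute = solve-∀ laurentSolverRing
  later : ∀ j → m *L m *L (c k (suc i) (suc j) *L h (k ℕ.+ suc j) n) ≋ up j +L same (suc j)
  later j = ≋-trans (reassociate m (c k (suc i) (suc j)) (h (k ℕ.+ suc j) n))
    (≋-trans (*-congʳ (h (k ℕ.+ suc j) n) (c-recurrence k i j))
    (≋-trans (distribute (c k i j) (N² j) (c k i (suc j)) (σ (k ℕ.+ suc j) +L -L σ i) (h (k ℕ.+ suc j) n))
             (+-congʳ (same (suc j)) (*-congˡ (c k i j) (*-congˡ (N² j)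
               (≋-reflexive (cong (λ t → h t n) (ℕP.+-suc k j))))))))

linearization : ∀ k i n → h k n *L h i n ≋ Σ< (suc i) (λ j → c k i j *L h (k ℕ.+ j) n)
linearization k zero n = begin
  h k n *L h 0 n            ≈⟨ *-congˡ (h k n) (h-zero n) ⟩
  h k n *L 1L               ≈⟨ *-identityʳ (h k n) ⟩
  h k n                     ≈⟨ ≋-reflexive (cong (λ t → h t n) (ℕP.+-identityʳ k)) ⟨
  h (k ℕ.+ 0) n             ≈⟨ *-identityˡ (h (k ℕ.+ 0) n) ⟨
  1L *L h (k ℕ.+ 0) n       ≈⟨ *-congʳ (h (k ℕ.+ 0) n) c₀₀≋1 ⟨
  c k 0 0 *L h (k ℕ.+ 0) n  ≈⟨ +-identityʳ (c k 0 0 *L h (k ℕ.+ 0) n) ⟨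
  c k 0 0 *L h (k ℕ.+ 0) n +L 0L ∎
  where
  open ≋-Reasoning
  c₀₀≋1 : c k 0 0 ≋ 1L
  c₀₀≋1 = ≋-trans (c≋c⁺ k 0 0 0 refl) (≋-trans
    (*L-cong (*L-cong (*L-cong (qˆ-cong (ℤP.neg-involutive 0ℤ)) (qbin-0 (k ℕ.+ 0))) (qbin-0 k)) (qbin-0 (k ℕ.+ 0)))
    (≋-trans (*-identityʳ (1L *L 1L *L 1L)) (≋-trans (*-identityʳ (1L *L 1L)) (*-identityʳ 1L))))
linearization k (suc i) n = cancel-square i (h k n *L h (suc i) n) _ (begin
  m *L m *L (h k n *L h (suc i) n)  ≈⟨ swap m (h k n) (h (suc i) n) ⟩
  h k n *L (m *L m *L h (suc i) n)  ≈⟨ *-congˡ (h k n) (h-recurrence i n) ⟩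
  h k n *L (W *L h i n)             ≈⟨ swap′ (h k n) W (h i n) ⟩
  W *L (h k n *L h i n)             ≈⟨ *-congˡ W (linearization k i n) ⟩
  W *L Σ< (suc i) (λ j → c k i j *L h (k ℕ.+ j) n) ≈⟨ linearization-step k i n ⟩
  m *L m *L Σ< (suc (suc i)) (λ j → c k (suc i) j *L h (k ℕ.+ j) n) ∎)
  where
  open ≋-Reasoning
  m = 1- q^ (suc i)
  W = σ n +L -L σ i
  swap : ∀ m X Y → m *L m *L (X *L Y) ≋ X *L (m *L m *L Y)
  swap = solve-∀ laurentSolverRing
  swap′ : ∀ X W Y → X *L (W *L Y) ≋ W *L (X *L Y)
  swap′ = solve-∀ laurentSolverRing

if-T : ∀ b {x y : Laurent} → T b → (if b then x else y) ≡ x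
if-T true _ = refl

if-¬T : ∀ b {x y : Laurent} → (T b → ⊥) → (if b then x else y) ≡ y
if-¬T true ¬t = ⊥-elim (¬t _)
if-¬T false _ = refl

InRange : ℕ → ℕ → ℕ → Bool
InRange r k i = (k ℕ.≤ᵇ i) ∧ (i ℕ.≤ᵇ suc (suc r) ℕ.* k)

P-vanish-below : ∀ r k i → i < k → P (suc r) k i ≋ 0L
P-vanish-below zero k i i<k =
  ≋-reflexive (if-¬T (k ℕ.≡ᵇ i) (λ t → ℕP.<-irrefl (sym (ℕP.≡ᵇ⇒≡ k i t)) i<k))
P-vanish-below (suc r) k i i<k =
  ≋-reflexive (if-¬T (InRange r k i) (λ t → ℕP.<⇒≱ i<k (ℕP.≤ᵇ⇒≤ k i (proj₁ (Equivalence.to T-∧ t)))))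

P-vanish-above : ∀ r k i → suc r ℕ.* k < i → P (suc r) k i ≋ 0L
P-vanish-above zero k i k<i =
  ≋-reflexive (if-¬T (k ℕ.≡ᵇ i) (λ t → ℕP.<-irrefl (trans (ℕP.+-identityʳ k) (ℕP.≡ᵇ⇒≡ k i t)) k<i))
P-vanish-above (suc r) k i R<i =
  ≋-reflexive (if-¬T (InRange r k i) (λ t → ℕP.<⇒≱ R<i (ℕP.≤ᵇ⇒≤ i _ (proj₂ (Equivalence.to T-∧ t)))))

P-1-diagonal : ∀ k → P 1 k k ≋ 1L
P-1-diagonal k = ≋-reflexive (if-T (k ℕ.≡ᵇ k) (ℕP.≡⇒≡ᵇ k k refl))

P-1-off-diagonal : ∀ k i → (i ≡ k → ⊥) → P 1 k i ≋ 0L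
P-1-off-diagonal k i i≢k = ≋-reflexive (if-¬T (k ℕ.≡ᵇ i) (λ t → i≢k (sym (ℕP.≡ᵇ⇒≡ k i t))))

P-recursion : ∀ r k j M → suc r ℕ.* k < M →
  Σ< M (λ i → c k i j *L P (suc r) k i) ≋ P (suc (suc r)) k (k ℕ.+ j)
P-recursion r k j M R<M with k ℕ.+ j ℕP.≤? suc (suc r) ℕ.* k
... | yes k+j≤R' = begin
  Σ< M f                                  ≈⟨ Σ<-extend (suc R) M f R<M (λ i R<i _ → *-vanishʳ (c k i j) (P-vanish-above r k i R<i)) ⟩
  Σ< (suc R) f                            ≡⟨ cong (λ t → Σ< t f) (ℕP.m+[n∸m]≡n k≤1+R) ⟨
  Σ< (k ℕ.+ (suc R ∸ k)) f                ≈⟨ Σ<-split k (suc R ∸ k) f ⟩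
  Σ< k f +L Σ< (suc R ∸ k) (λ t → f (k ℕ.+ t))
    ≈⟨ +-congʳ (Σ< (suc R ∸ k) (λ t → f (k ℕ.+ t))) (Σ<-zero k f (λ i i<k → *-vanishʳ (c k i j) (P-vanish-below r k i i<k))) ⟩
  0L +L Σ< (suc R ∸ k) (λ t → f (k ℕ.+ t)) ≈⟨ +-identityˡ (Σ< (suc R ∸ k) (λ t → f (k ℕ.+ t))) ⟩
  Σ< (suc R ∸ k) (λ t → f (k ℕ.+ t))       ≡⟨ sumRange≡Σ< k R f ⟨
  sumRange k R f                           ≡⟨ cong (λ j' → sumRange k R (λ i → c k i j' *L P (suc r) k i)) (ℕP.m+n∸m≡n k j) ⟨
  sumRange k R (λ i → c k i ((k ℕ.+ j) ∸ k) *L P (suc r) k i)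
    ≡⟨ if-T (InRange r k (k ℕ.+ j)) (Equivalence.from T-∧ (ℕP.≤⇒≤ᵇ (ℕP.m≤m+n k j) , ℕP.≤⇒≤ᵇ k+j≤R')) ⟨
  P (suc (suc r)) k (k ℕ.+ j)              ∎
  where
  open ≋-Reasoning
  R = suc r ℕ.* k
  f : ℕ → Laurent
  f i = c k i j *L P (suc r) k i
  k≤1+R : k ≤ suc R
  k≤1+R = ℕP.m≤n⇒m≤1+n (ℕP.m≤m+n k (r ℕ.* k))
... | no k+j≰R' = ≋-trans (Σ<-zero M _ (λ i _ → vanish i))
    (≋-sym (≋-reflexive (if-¬T (InRange r k (k ℕ.+ j)) (λ t → k+j≰R' (ℕP.≤ᵇ⇒≤ (k ℕ.+ j) _ (proj₂ (Equivalence.to T-∧ t)))))))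
  where
  R = suc r ℕ.* k
  -- j > R, so for i ≤ R the coefficient c k i j vanishes, and for i > R the polynomial P does
  vanish : ∀ i → c k i j *L P (suc r) k i ≋ 0L
  vanish i with R ℕP.<? i
  ... | yes R<i = *-vanishʳ (c k i j) (P-vanish-above r k i R<i)
  ... | no R≮i = *-vanishˡ (P (suc r) k i) (c-vanish k i j (ℕP.≤-<-trans (ℕP.≮⇒≥ R≮i)
                   (ℕP.+-cancelˡ-< k R j (ℕP.≰⇒> k+j≰R'))))

-- h k n ^ (r+1) = Σ_{i<M} P^{(r+1)}_{k,i} · h i n  for any M > (r+1)k,
-- by induction on r: multiply by h k n, linearize each h k n · h i n, swap
-- the two sums and recognise the recursion of P.
h-power : ∀ r k n M → suc r ℕ.* k < M → h k n ^L suc r ≋ Σ< M (λ i → P (suc r) k i *L h i n)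
h-power zero k n M k<M = begin
  h k n *L 1L                         ≈⟨ *-identityʳ (h k n) ⟩
  h k n                               ≈⟨ *-identityˡ (h k n) ⟨
  1L *L h k n                         ≈⟨ *-congʳ (h k n) (P-1-diagonal k) ⟨
  P 1 k k *L h k n                    ≈⟨ Σ<-single M k (λ i → P 1 k i *L h i n) (subst (_< M) (ℕP.+-identityʳ k) k<M)
                                           (λ i i≢k → *-vanishˡ (h i n) (P-1-off-diagonal k i i≢k)) ⟨
  Σ< M (λ i → P 1 k i *L h i n)        ∎
  where open ≋-Reasoning
h-power (suc r) k n M R'<M = begin
  h k n *L (h k n ^L suc r)                          ≈⟨ *-congˡ (h k n) (h-power r k n M R<M) ⟩
  h k n *L Σ< M (λ i → P (suc r) k i *L h i n)       ≈⟨ Σ<-*ˡ M (h k n) (λ i → P (suc r) k i *L h i n) ⟩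
  Σ< M (λ i → h k n *L (P (suc r) k i *L h i n))     ≈⟨ Σ<-cong M (λ i i<M → linearize i i<M) ⟩
  Σ< M (λ i → Σ< M (λ j → term i j))                ≈⟨ Σ<-swap M M term ⟩
  Σ< M (λ j → Σ< M (λ i → term i j))                ≈⟨ Σ<-cong M (λ j _ → collect j) ⟩
  Σ< M (λ j → P (suc (suc r)) k (k ℕ.+ j) *L h (k ℕ.+ j) n)
    ≈⟨ Σ<-shift k M (λ i → P (suc (suc r)) k i *L h i n) k≤M
         (λ i i<k → *-vanishˡ (h i n) (P-vanish-below (suc r) k i i<k))
         (λ j M-k≤j _ → *-vanishˡ (h (k ℕ.+ j) n) (P-vanish-above (suc r) k (k ℕ.+ j) (large j M-k≤j))) ⟩
  Σ< M (λ i → P (suc (suc r)) k i *L h i n) ∎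
  where
  open ≋-Reasoning
  term : ℕ → ℕ → Laurent
  term i j = (c k i j *L P (suc r) k i) *L h (k ℕ.+ j) n
  R<M : suc r ℕ.* k < M
  R<M = ℕP.≤-<-trans (ℕP.m≤n+m (suc r ℕ.* k) k) R'<M
  k≤M : k ≤ M
  k≤M = ℕP.<⇒≤ (ℕP.≤-<-trans (ℕP.m≤m+n k (suc r ℕ.* k)) R'<M)
  large : ∀ j → M ∸ k ≤ j → suc (suc r) ℕ.* k < k ℕ.+ j
  large j M-k≤j = ℕP.<-≤-trans R'<M (subst (_≤ k ℕ.+ j) (ℕP.m+[n∸m]≡n k≤M) (ℕP.+-monoʳ-≤ k M-k≤j))
  move : ∀ p c H → p *L (c *L H) ≋ (c *L p) *L H
  move = solve-∀ laurentSolverRing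
  rotate : ∀ H p G → H *L (p *L G) ≋ p *L (H *L G)
  rotate = solve-∀ laurentSolverRing
  linearize : ∀ i → i < M → h k n *L (P (suc r) k i *L h i n) ≋ Σ< M (λ j → term i j)
  linearize i i<M = begin
    h k n *L (P (suc r) k i *L h i n)   ≈⟨ rotate (h k n) (P (suc r) k i) (h i n) ⟩
    P (suc r) k i *L (h k n *L h i n)   ≈⟨ *-congˡ (P (suc r) k i) (linearization k i n) ⟩
    P (suc r) k i *L Σ< (suc i) (λ j → c k i j *L h (k ℕ.+ j) n)
      ≈⟨ *-congˡ (P (suc r) k i) (Σ<-extend (suc i) M (λ j → c k i j *L h (k ℕ.+ j) n) i<M
           (λ j i<j _ → *-vanishˡ (h (k ℕ.+ j) n) (c-vanish k i j i<j))) ⟨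
    P (suc r) k i *L Σ< M (λ j → c k i j *L h (k ℕ.+ j) n)
      ≈⟨ Σ<-*ˡ M (P (suc r) k i) (λ j → c k i j *L h (k ℕ.+ j) n) ⟩
    Σ< M (λ j → P (suc r) k i *L (c k i j *L h (k ℕ.+ j) n))
      ≈⟨ Σ<-cong M (λ j _ → move (P (suc r) k i) (c k i j) (h (k ℕ.+ j) n)) ⟩
    Σ< M (λ j → term i j) ∎
  collect : ∀ j → Σ< M (λ i → term i j) ≋ P (suc (suc r)) k (k ℕ.+ j) *L h (k ℕ.+ j) n
  collect j = ≋-trans (≋-sym (Σ<-*ʳ M (λ i → c k i j *L P (suc r) k i) (h (k ℕ.+ j) n)))
                      (*-congʳ (h (k ℕ.+ j) n) (P-recursion r k j M R<M))

-- Positivity: q-binomials, the coefficients c and hence every P have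
-- nonnegative coefficients, since they are built from q-binomials and
-- monomials by sums and products.

NonnegP : Poly → Set
NonnegP xs = ∀ m → 0ℤ ℤ.≤ coeffP xs m

nonneg-≋ : ∀ {p q} → p ≋ q → NonnegCoeffs p → NonnegCoeffs q
nonneg-≋ ⟪ e ⟫ n z = subst (0ℤ ℤ.≤_) (e z) (n z)

nonneg-mkL⁻¹ : ∀ e xs → NonnegCoeffs (mkL e xs) → NonnegP xs
nonneg-mkL⁻¹ e xs p m = subst (0ℤ ℤ.≤_) (coeff-mkL-offset e xs m) (p (e ℤ.+ + m))

nonneg-mkL : ∀ e xs → NonnegP xs → NonnegCoeffs (mkL e xs)
nonneg-mkL e xs p z = subst (0ℤ ℤ.≤_) (sym (coeff-mkL e xs z)) (at (z ℤ.- e))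
  where
  at : ∀ w → 0ℤ ℤ.≤ coeffAt xs w
  at (+ m) = p m
  at -[1+ n ] = ℤP.≤-refl

nonneg-+ : ∀ p q → NonnegCoeffs p → NonnegCoeffs q → NonnegCoeffs (p +L q)
nonneg-+ p q a b z = subst (0ℤ ℤ.≤_) (sym (coeff-+L p q z)) (ℤP.+-mono-≤ (a z) (b z))

nonneg-*P : ∀ xs ys → NonnegP xs → NonnegP ys → NonnegP (xs *P ys)
nonneg-*P [] ys a b m = ℤP.≤-refl
nonneg-*P (x ∷ xs) ys a b m =
  subst (0ℤ ℤ.≤_) (sym (coeffP-*P x xs ys m)) (ℤP.+-mono-≤ (product (a 0) (b m)) (rest m))
  where
  product : ∀ {x y} → 0ℤ ℤ.≤ x → 0ℤ ℤ.≤ y → 0ℤ ℤ.≤ x ℤ.* y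
  product {+ m} {+ n} _ _ = subst (0ℤ ℤ.≤_) (ℤP.pos-* m n) (ℤ.+≤+ ℕ.z≤n)
  rest : NonnegP (0ℤ ∷ (xs *P ys))
  rest zero = ℤP.≤-refl
  rest (suc m) = nonneg-*P xs ys (λ k → a (suc k)) b m

nonneg-* : ∀ p q → NonnegCoeffs p → NonnegCoeffs q → NonnegCoeffs (p *L q)
nonneg-* (mkL e xs) (mkL f ys) a b =
  nonneg-mkL (e ℤ.+ f) (xs *P ys) (nonneg-*P xs ys (nonneg-mkL⁻¹ e xs a) (nonneg-mkL⁻¹ f ys b))

nonneg-0L : NonnegCoeffs 0L
nonneg-0L z = subst (0ℤ ℤ.≤_) (sym (coeff-0L z)) ℤP.≤-refl

nonneg-qˆ : ∀ z → NonnegCoeffs (qˆ z)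
nonneg-qˆ z = nonneg-mkL z (1ℤ ∷ []) (λ { zero → ℤ.+≤+ ℕ.z≤n ; (suc m) → ℤP.≤-refl })

nonneg-qbin : ∀ n k → NonnegCoeffs (qbin n k)
nonneg-qbin n zero = nonneg-≋ (≋-sym (qbin-0 n)) (nonneg-qˆ 0ℤ)
nonneg-qbin zero (suc k) = nonneg-0L
nonneg-qbin (suc n) (suc k) = nonneg-≋ (≋-sym (qbin-pascal n k))
  (nonneg-+ (qbin n k) (q^ (suc k) *L qbin n (suc k)) (nonneg-qbin n k)
            (nonneg-* (q^ (suc k)) (qbin n (suc k)) (nonneg-qˆ (+ suc k)) (nonneg-qbin n (suc k))))

nonneg-qbinℤ : ∀ k z → NonnegCoeffs (qbinℤ k z)
nonneg-qbinℤ k (+ m) = nonneg-qbin k m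
nonneg-qbinℤ k -[1+ m ] = nonneg-0L

nonneg-Σ< : ∀ N f → (∀ t → NonnegCoeffs (f t)) → NonnegCoeffs (Σ< N f)
nonneg-Σ< zero f p = nonneg-0L
nonneg-Σ< (suc N) f p = nonneg-+ (f 0) (Σ< N (λ t → f (suc t))) (p 0) (nonneg-Σ< N (λ t → f (suc t)) (λ t → p (suc t)))

nonneg-c : ∀ k i j → NonnegCoeffs (c k i j)
nonneg-c k i j = nonneg-* _ (qbin (k ℕ.+ j) j)
  (nonneg-* _ (qbinℤ k (+ i ℤ.- + j))
    (nonneg-* (qˆ ((+ j ℤ.- + i) ℤ.* + (j ℕ.+ k))) (qbin (k ℕ.+ i) i) (nonneg-qˆ _) (nonneg-qbin (k ℕ.+ i) i))
    (nonneg-qbinℤ k (+ i ℤ.- + j)))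
  (nonneg-qbin (k ℕ.+ j) j)

nonneg-if : ∀ b {x y} → NonnegCoeffs x → NonnegCoeffs y → NonnegCoeffs (if b then x else y)
nonneg-if true a b = a
nonneg-if false a b = b

nonneg-P : ∀ r k i → NonnegCoeffs (P r k i)
nonneg-P zero k i = nonneg-0L
nonneg-P (suc zero) k i = nonneg-if (k ℕ.≡ᵇ i) (nonneg-qˆ 0ℤ) nonneg-0L
nonneg-P (suc (suc r)) k i = nonneg-if (InRange r k i)
  (subst NonnegCoeffs (sym (sumRange≡Σ< k (suc r ℕ.* k) f))
    (nonneg-Σ< (suc (suc r ℕ.* k) ∸ k) (λ t → f (k ℕ.+ t))
      (λ t → nonneg-* (c k (k ℕ.+ t) (i ∸ k)) (P (suc r) k (k ℕ.+ t))
               (nonneg-c k (k ℕ.+ t) (i ∸ k)) (nonneg-P (suc r) k (k ℕ.+ t)))))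
  nonneg-0L
  where
  f : ℕ → Laurent
  f i' = c k i' (i ∸ k) *L P (suc r) k i'

LHS-term : ∀ r k n →
  qˆ (ℤ.- + (r ℕ.* k ℕ.* n)) *L (qbin n k ^L r) *L (qbin (n ℕ.+ k) k ^L r) ≋ h k n ^L r
LHS-term zero k n = ≋-trans (*-identityʳ (1L *L 1L)) (*-identityʳ 1L)
LHS-term (suc r) k n = ≋-sym (begin
  (W *L A *L B) *L (h k n ^L r)                      ≈⟨ *-congˡ (W *L A *L B) (LHS-term r k n) ⟨
  (W *L A *L B) *L (Wr *L (A ^L r) *L (B ^L r))      ≈⟨ regroup W A B Wr (A ^L r) (B ^L r) ⟩
  (W *L Wr) *L (A *L (A ^L r)) *L (B *L (B ^L r))
    ≈⟨ *-congʳ (B *L (B ^L r)) (*-congʳ (A *L (A ^L r)) (≋-trans (qˆ-+ (ℤ.- + (n ℕ.* k)) (ℤ.- + (r ℕ.* k ℕ.* n)))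
         (qˆ-cong (trans (sym (ℤP.neg-distrib-+ (+ (n ℕ.* k)) (+ (r ℕ.* k ℕ.* n)))) (cong (λ t → ℤ.- + t) (exponent r k n)))))) ⟩
  qˆ (ℤ.- + (suc r ℕ.* k ℕ.* n)) *L (A *L (A ^L r)) *L (B *L (B ^L r)) ∎)
  where
  open ≋-Reasoning
  W = qˆ (ℤ.- + (n ℕ.* k))
  Wr = qˆ (ℤ.- + (r ℕ.* k ℕ.* n))
  A = qbin n k
  B = qbin (n ℕ.+ k) k
  regroup : ∀ x A B y Ar Br → (x *L A *L B) *L (y *L Ar *L Br) ≋ (x *L y) *L (A *L Ar) *L (B *L Br)
  regroup = solve-∀ laurentSolverRing
  exponent : ∀ r k n → n ℕ.* k ℕ.+ r ℕ.* k ℕ.* n ≡ suc r ℕ.* k ℕ.* n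
  exponent = ℕSolver.solve-∀

bCoeff : ℕ → ℕ → Laurent
bCoeff r i = sumTo i (λ k → P r k i)

-- Σ_{k≤n} h k n ^ (r+1) = Σ_{i≤n} h i n · b_i: expand every power in the
-- basis, exchange the sums, and drop the terms with i > n (where h i n = 0)
-- and with k > i (where P_{k,i} = 0).
identity : ∀ r n → LHS (suc r) n ≋ RHS (bCoeff (suc r)) n
identity r n = begin
  LHS (suc r) n                                       ≡⟨ sumTo≡Σ< n term ⟩
  Σ< (suc n) term                                     ≈⟨ Σ<-cong (suc n) (λ k _ → LHS-term (suc r) k n) ⟩
  Σ< (suc n) (λ k → h k n ^L suc r)                   ≈⟨ Σ<-cong (suc n) (λ k k≤n → h-power r k n M (bound k k≤n)) ⟩
  Σ< (suc n) (λ k → Σ< M (λ i → P (suc r) k i *L h i n)) ≈⟨ Σ<-swap (suc n) M (λ k i → P (suc r) k i *L h i n) ⟩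
  Σ< M (λ i → Σ< (suc n) (λ k → P (suc r) k i *L h i n))
    ≈⟨ Σ<-cong M (λ i _ → ≋-sym (Σ<-*ʳ (suc n) (λ k → P (suc r) k i) (h i n))) ⟩
  Σ< M (λ i → Σ< (suc n) (λ k → P (suc r) k i) *L h i n)
    ≈⟨ Σ<-extend (suc n) M _ n<M (λ i n<i _ → *-vanishʳ (Σ< (suc n) (λ k → P (suc r) k i)) (h-vanish i n n<i)) ⟩
  Σ< (suc n) (λ i → Σ< (suc n) (λ k → P (suc r) k i) *L h i n)
    ≈⟨ Σ<-cong (suc n) (λ i i≤n → ≋-trans (*-congʳ (h i n) (Σ<-extend (suc i) (suc n) (λ k → P (suc r) k i) i≤n
                                                              (λ k i<k _ → P-vanish-below r k i i<k)))
                                          (*-comm (Σ< (suc i) (λ k → P (suc r) k i)) (h i n))) ⟩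
  Σ< (suc n) (λ i → h i n *L Σ< (suc i) (λ k → P (suc r) k i))
    ≈⟨ Σ<-cong (suc n) (λ i _ → *-congˡ (h i n) (≋-reflexive (sumTo≡Σ< i (λ k → P (suc r) k i)))) ⟨
  Σ< (suc n) (λ i → h i n *L bCoeff (suc r) i)             ≡⟨ sumTo≡Σ< n _ ⟨
  RHS (bCoeff (suc r)) n                                   ∎
  where
  open ≋-Reasoning
  M = suc (suc r ℕ.* n)
  term : ℕ → Laurent
  term k = qˆ (ℤ.- + (suc r ℕ.* k ℕ.* n)) *L (qbin n k ^L suc r) *L (qbin (n ℕ.+ k) k ^L suc r)
  bound : ∀ k → k < suc n → suc r ℕ.* k < M
  bound k (ℕ.s≤s k≤n) = ℕ.s≤s (ℕP.*-monoʳ-≤ (suc r) k≤n)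
  n<M : suc n ≤ M
  n<M = ℕ.s≤s (ℕP.m≤m+n n (r ℕ.* n))

h-diagonal-cancelˡ : ∀ i X Y → h i i *L X ≋ h i i *L Y → X ≋ Y
h-diagonal-cancelˡ i X Y eq = *L-cancelˡ (qbin-constant-one (i ℕ.+ i) i (ℕP.m≤n+m i i)) X Y
  (qˆ-cancelˡ (ℤ.- + (i ℕ.* i)) (B *L X) (B *L Y) (begin
    W *L (B *L X)   ≈⟨ *-assoc W B X ⟨
    W *L B *L X     ≈⟨ *-congʳ X (h-diagonal i) ⟨
    h i i *L X      ≈⟨ eq ⟩
    h i i *L Y      ≈⟨ *-congʳ Y (h-diagonal i) ⟩
    W *L B *L Y     ≈⟨ *-assoc W B Y ⟩
    W *L (B *L Y)   ∎))
  where
  open ≋-Reasoning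
  W = qˆ (ℤ.- + (i ℕ.* i))
  B = qbin (i ℕ.+ i) i

-- The expansion in the basis h determines its coefficients: the system is
-- triangular (RHS b n involves only b_0, …, b_n) with cancellable diagonal,
-- so b_i is recovered from RHS b i by strong induction on i.
expansion-unique : ∀ b₁ b₂ → (∀ n → RHS b₁ n ≋ RHS b₂ n) → ∀ i → b₁ i ≋ b₂ i
expansion-unique b₁ b₂ eq = <-rec (λ i → b₁ i ≋ b₂ i) step
  where
  term : (ℕ → Laurent) → ℕ → ℕ → Laurent
  term b n j = h j n *L b j
  step : ∀ i → (∀ {j} → j < i → b₁ j ≋ b₂ j) → b₁ i ≋ b₂ i
  step i ih = h-diagonal-cancelˡ i (b₁ i) (b₂ i) (+-cancelˡ (Σ< i (term b₁ i)) (term b₁ i i) (term b₂ i i) (begin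
    Σ< i (term b₁ i) +L term b₁ i i   ≈⟨ Σ<-last i (term b₁ i) ⟨
    Σ< (suc i) (term b₁ i)            ≡⟨ sumTo≡Σ< i (term b₁ i) ⟨
    RHS b₁ i                          ≈⟨ eq i ⟩
    RHS b₂ i                          ≡⟨ sumTo≡Σ< i (term b₂ i) ⟩
    Σ< (suc i) (term b₂ i)            ≈⟨ Σ<-last i (term b₂ i) ⟩
    Σ< i (term b₂ i) +L term b₂ i i   ≈⟨ +-congʳ (term b₂ i i) (Σ<-cong i (λ j j<i → *-congˡ (h j i) (ih j<i))) ⟨
    Σ< i (term b₁ i) +L term b₂ i i   ∎))
    where open ≋-Reasoning

theorem1p3 : (r : ℕ) → 1 ≤ r →
    Σ[ b ∈ (ℕ → Laurent) ]
      ( (∀ i → NonnegCoeffs (b i))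
      × (∀ n → LHS r n ≈ RHS b n)
      × (∀ (b' : ℕ → Laurent) → (∀ i → NonnegCoeffs (b' i)) →
           (∀ n → LHS r n ≈ RHS b' n) → ∀ i → b' i ≈ b i)
      × (∀ i → b i ≈ sumTo i (λ k → P r k i)) )
theorem1p3 (suc r) _ = bCoeff (suc r) , nonneg , (λ n → coeffwise (identity r n)) , unique , (λ i → ≈-refl)
  where
  nonneg : ∀ i → NonnegCoeffs (bCoeff (suc r) i)
  nonneg i = subst NonnegCoeffs (sym (sumTo≡Σ< i (λ k → P (suc r) k i)))
                   (nonneg-Σ< (suc i) (λ k → P (suc r) k i) (λ k → nonneg-P (suc r) k i))
  unique : ∀ b' → (∀ i → NonnegCoeffs (b' i)) → (∀ n → LHS (suc r) n ≈ RHS b' n) → ∀ i → b' i ≈ bCoeff (suc r) i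
  unique b' _ b'-identity i = coeffwise
    (expansion-unique b' (bCoeff (suc r)) (λ n → ≋-trans (≋-sym ⟪ b'-identity n ⟫) (identity r n)) i)
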